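{- For every integer $k\ge 2$, every graph $F$ on $k$ vertices, and every $d\in(0,1)$, if $n\ge (4/d)^{2k}$ and $0<\rho\le (d/4)^{2k}$, then every $n$-vertex $(\rho,d)$-dense graph $\Gamma$ whose edges are colored with two colors contains at least $\gamma n^k$ monochromatic copies of $F$, where $\gamma=d^{2k^2}2^{ -5k^2}$.
   Context: For $0<d,\rho\le1$, an $n$-vertex graph $\Gamma$ is $(\rho,d)$-dense if every induced subgraph of $\Gamma$ on $m\ge\rho n$ vertices contains at least $d\,m^2/2$ edges. A copy of $F$ in $\Gamma$ is a subgraph of $\Gamma$ isomorphic to $F$; it is monochromatic if all its edges have the same color.
   Formalization: The parameters d and ρ take only rational values. -}

module Defs where

open import Data.Bool using (Bool; true; false; _∧_; if_then_else_)
open import Data.Nat as ℕ using (ℕ; zero; suc)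
open import Data.Integer using (+_)
open import Data.Fin using (Fin; toℕ)
open import Data.Fin.Subset using (Subset; ∣_∣)
open import Data.Vec using (lookup)
open import Data.List using (List; allFin; map; length)
open import Data.Nat.ListAction using (sum)
open import Data.List.Relation.Unary.All using (All)
open import Data.List.Relation.Unary.AllPairs using (AllPairs)
open import Data.Product using (Σ; ∃; ∃₂; _×_)
open import Data.Rational as ℚ using (ℚ; 1ℚ; _≤_; _<_; _*_; _/_)
open import Relation.Binary.PropositionalEquality using (_≡_)
open import Relation.Nullary using (¬_)
open import Relation.Nullary.Decidable using (⌊_⌋)
open import Function.Definitions using (Injective)
open import Function.Bundles using (_⇔_)

infixr 8 _^ℚ_
_^ℚ_ : ℚ → ℕ → ℚ
q ^ℚ zero  = 1ℚ
q ^ℚ suc m = q * (q ^ℚ m)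

[_]ℚ : ℕ → ℚ
[ n ]ℚ = + n / 1

record Graph (n : ℕ) : Set where
  field
    adj    : Fin n → Fin n → Bool
    sym    : ∀ u v → adj u v ≡ adj v u
    irrefl : ∀ v → adj v v ≡ false
open Graph public

-- a 2-colouring of the edges of Γ (colours = Bool); a colour is attached to
-- each (unordered) pair, hence symmetric; only its values on edges matter
record TwoColouring {n : ℕ} (Γ : Graph n) : Set where
  field
    col    : Fin n → Fin n → Bool
    colSym : ∀ u v → col u v ≡ col v u
open TwoColouring public

edgesIn : ∀ {n} → Graph n → Subset n → ℕ
edgesIn {n} Γ S =
  sum (map (λ u → sum (map (λ v →
    if ⌊ toℕ u ℕ.<? toℕ v ⌋ ∧ lookup S u ∧ lookup S v ∧ adj Γ u v then 1 else 0)
    (allFin n))) (allFin n))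

Dense : ∀ {n} → ℚ → ℚ → Graph n → Set
Dense {n} ρ d Γ =
  (S : Subset n) → ρ * [ n ]ℚ ≤ [ ∣ S ∣ ]ℚ →
  d * [ ∣ S ∣ ℕ.* ∣ S ∣ ]ℚ * (+ 1 / 2) ≤ [ edgesIn Γ S ]ℚ

-- an embedding of F into Γ (injective, edge-preserving map); each embedding
-- determines a copy of F in Γ (its image subgraph), see SameCopy
record Embedding {k n : ℕ} (F : Graph k) (Γ : Graph n) : Set where
  field
    φ   : Fin k → Fin n
    inj : Injective _≡_ _≡_ φ
    hom : ∀ i j → adj F i j ≡ true → adj Γ (φ i) (φ j) ≡ true
open Embedding public

SameCopy : ∀ {k n} {F : Graph k} {Γ : Graph n} → Embedding F Γ → Embedding F Γ → Set
SameCopy {F = F} e e' =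
  (∀ v → (∃ λ i → φ e i ≡ v) ⇔ (∃ λ i → φ e' i ≡ v)) ×
  (∀ u v → (∃₂ λ i j → adj F i j ≡ true × φ e i ≡ u × φ e j ≡ v)
         ⇔ (∃₂ λ i j → adj F i j ≡ true × φ e' i ≡ u × φ e' j ≡ v))

Monochromatic : ∀ {k n} {F : Graph k} {Γ : Graph n} → TwoColouring Γ → Embedding F Γ → Set
Monochromatic {F = F} c e =
  ∃ λ (b : Bool) → ∀ i j → adj F i j ≡ true → col c (φ e i) (φ e j) ≡ b

AtLeastMonoCopies : ∀ {k n} (F : Graph k) (Γ : Graph n) → TwoColouring Γ → ℚ → Set
AtLeastMonoCopies F Γ c x =
  Σ (List (Embedding F Γ)) λ L →
    All (Monochromatic c) L × AllPairs (λ e e' → ¬ SameCopy e e') L × x ≤ [ length L ]ℚ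

{-# OPTIONS --safe #-}

-- Every monochromatic k-clique of Γ carries a monochromatic copy of F, and distinct cliques carry
-- distinct copies, so it suffices to count monochromatic k-cliques. Write R_j(S) and B_j(S) for the
-- numbers of red and blue j-cliques inside a vertex set S. An Erdős–Szekeres type induction on (a, b)
-- shows, for e = (d/4)^(k+1)/k, that e^(a+b) ≤ R_(a+1)(S) s^(a+1) + B_(b+1)(S) s^(b+1) whenever
-- s|S| ≥ 1 and S stays large compared with ρn. In the step, a vertex of degree at least d|S|/2 has a colour class of size at
-- least d|S|/4 in its neighbourhood, to which the induction hypothesis applies at scale 4s/d; summing
-- these bounds over all vertices, with Σ_v R_(a+1)(N_red(v)) = (a+2) R_(a+2)(S) and the density bound
-- Σ_v deg(v) ≥ d|S|², gives the statement for (a+1, b+1). Taking S = V(Γ), s = 1/n and a = b = k-1,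
-- one colour has at least e^(2k-2) n^k / 2 ≥ γ n^k cliques of size k.
module Submission where

open import Algebra.Bundles using (CommutativeMonoid)
open import Data.Bool as Bool using (Bool; true; false; not; _∧_; if_then_else_; T)
open import Data.Bool.Properties using (∧-zeroʳ; not-involutive; T-≡)
open import Data.Empty using (⊥-elim)
open import Data.Fin using (Fin; toℕ)
import Data.Fin.Properties as Finₚ
open import Data.Fin.Subset using (∣_∣)
open import Data.Integer as ℤ using (+_)
import Data.Integer.Properties as ℤₚ
open import Data.List using (List; []; _∷_; _++_; map; filterᵇ; length; allFin)
import Data.List.Properties as Listₚ
open import Data.List.Membership.Propositional using (_∈_)
open import Data.List.Membership.Propositional.Properties using (∈-filter⁻)
open import Data.List.Relation.Binary.Sublist.Propositional using (_⊆_; []; _∷_; _∷ʳ_)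
open import Data.List.Relation.Binary.Sublist.Propositional.Properties using (filter-⊆; filter⁺)
import Data.List.Relation.Unary.All as All
import Data.List.Relation.Unary.All.Properties as Allₚ
import Data.List.Relation.Unary.AllPairs as AllPairs
import Data.List.Relation.Unary.AllPairs.Properties as AllPairsₚ
open import Data.List.Relation.Unary.Any using (here; there)
open import Data.List.Relation.Unary.Unique.Propositional using (Unique)
import Data.List.Relation.Unary.Unique.Propositional.Properties as Uniqueₚ
open import Data.Nat as ℕ using (ℕ; zero; suc; z≤n; s≤s; _≤?_)
import Data.Nat.Coprimality as Coprime
open import Data.Nat.ListAction using (sum)
import Data.Nat.Properties as ℕₚ
open import Data.Nat.Tactic.RingSolver using (solve-∀)
open import Data.Product using (∃; _×_; _,_; proj₁; proj₂)
open import Data.Rational as ℚ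
  using (ℚ; mkℚ; 0ℚ; 1ℚ; _≤_; _<_; _+_; _*_; -_; _/_; _÷_; 1/_; >-nonZero)
import Data.Rational.Properties as ℚₚ
open import Data.Rational.Properties
  using (≤-refl; ≤-trans; ≤-reflexive; <⇒≤; <-≤-trans; +-mono-≤; +-monoˡ-≤; +-monoʳ-≤)
open import Data.Rational.Solver using (module +-*-Solver)
import Data.Rational.Unnormalised as ℚᵘ
import Data.Rational.Unnormalised.Properties as ℚᵘₚ
import Data.Vec as Vec
import Data.Vec.Properties as Vecₚ
open import Defs hiding (sym)
open import Function using (_∘_; id; _on_)
open import Function.Bundles using (_⇔_; mk⇔; Equivalence)
open import Level using (0ℓ)
open import Relation.Binary.PropositionalEquality
open import Relation.Nullary using (¬_; Dec; yes; no)
open import Relation.Nullary.Decidable using (⌊_⌋)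

open +-*-Solver

fromℕ : ℕ → ℚ
fromℕ n = mkℚ (+ n) 0 (Coprime.sym (Coprime.1-coprimeTo n))

[]ℚ≡fromℕ : ∀ n → [ n ]ℚ ≡ fromℕ n
[]ℚ≡fromℕ n = ℚₚ.normalize-coprime (Coprime.sym (Coprime.1-coprimeTo n))

[]ℚ-homo-+ : ∀ m n → [ m ℕ.+ n ]ℚ ≡ [ m ]ℚ + [ n ]ℚ
[]ℚ-homo-+ m n rewrite []ℚ≡fromℕ (m ℕ.+ n) | []ℚ≡fromℕ m | []ℚ≡fromℕ n =
  ℚₚ.toℚᵘ-injective
    (ℚᵘₚ.≃-sym (ℚᵘₚ.≃-trans (ℚₚ.toℚᵘ-homo-+ (fromℕ m) (fromℕ n)) (ℚᵘ.*≡* cross)))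
  where
  cross : (+ m ℤ.* + 1 ℤ.+ + n ℤ.* + 1) ℤ.* + 1 ≡ + (m ℕ.+ n) ℤ.* (+ 1 ℤ.* + 1)
  cross rewrite ℤₚ.*-identityʳ (+ m) | ℤₚ.*-identityʳ (+ n) | ℤₚ.*-identityʳ (+ (m ℕ.+ n)) = refl

[]ℚ-homo-* : ∀ m n → [ m ℕ.* n ]ℚ ≡ [ m ]ℚ * [ n ]ℚ
[]ℚ-homo-* m n rewrite []ℚ≡fromℕ (m ℕ.* n) | []ℚ≡fromℕ m | []ℚ≡fromℕ n =
  ℚₚ.toℚᵘ-injective
    (ℚᵘₚ.≃-sym (ℚᵘₚ.≃-trans (ℚₚ.toℚᵘ-homo-* (fromℕ m) (fromℕ n)) (ℚᵘ.*≡* cross)))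
  where
  cross : (+ m ℤ.* + n) ℤ.* + 1 ≡ + (m ℕ.* n) ℤ.* (+ 1 ℤ.* + 1)
  cross rewrite ℤₚ.*-identityʳ (+ m ℤ.* + n) | ℤₚ.*-identityʳ (+ (m ℕ.* n)) = ℤₚ.+◃n≡+n (m ℕ.* n)

[]ℚ-mono-≤ : ∀ {m n} → m ℕ.≤ n → [ m ]ℚ ≤ [ n ]ℚ
[]ℚ-mono-≤ {m} {n} m≤n rewrite []ℚ≡fromℕ m | []ℚ≡fromℕ n = ℚ.*≤* cross
  where
  cross : + m ℤ.* + 1 ℤ.≤ + n ℤ.* + 1
  cross rewrite ℤₚ.*-identityʳ (+ m) | ℤₚ.*-identityʳ (+ n) = ℤ.+≤+ m≤n

[]ℚ-cancel-≤ : ∀ {m n} → [ m ]ℚ ≤ [ n ]ℚ → m ℕ.≤ n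
[]ℚ-cancel-≤ {m} {n} le rewrite []ℚ≡fromℕ m | []ℚ≡fromℕ n = cancel le
  where
  cancel : fromℕ m ≤ fromℕ n → m ℕ.≤ n
  cancel (ℚ.*≤* cross) rewrite ℤₚ.*-identityʳ (+ m) | ℤₚ.*-identityʳ (+ n) = ℤₚ.drop‿+≤+ cross

[]ℚ-nonNeg : ∀ n → 0ℚ ≤ [ n ]ℚ
[]ℚ-nonNeg n = []ℚ-mono-≤ {0} {n} z≤n

[]ℚ-pos : ∀ n → 0ℚ < [ suc n ]ℚ
[]ℚ-pos n = <-≤-trans (ℚₚ.positive⁻¹ 1ℚ) ([]ℚ-mono-≤ {1} {suc n} (s≤s z≤n))

*-nonNeg : ∀ {p q} → 0ℚ ≤ p → 0ℚ ≤ q → 0ℚ ≤ p * q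
*-nonNeg {p} {q} 0≤p 0≤q = ℚₚ.nonNegative⁻¹ _
  {{ℚₚ.nonNeg*nonNeg⇒nonNeg p {{ℚ.nonNegative 0≤p}} q {{ℚ.nonNegative 0≤q}}}}

*-pos : ∀ {p q} → 0ℚ < p → 0ℚ < q → 0ℚ < p * q
*-pos {p} {q} 0<p 0<q = ℚₚ.positive⁻¹ _
  {{ℚₚ.pos*pos⇒pos p {{ℚ.positive 0<p}} q {{ℚ.positive 0<q}}}}

+-nonNeg : ∀ {p q} → 0ℚ ≤ p → 0ℚ ≤ q → 0ℚ ≤ p + q
+-nonNeg = +-mono-≤

*-monoˡ-≤ : ∀ {r p q} → 0ℚ ≤ r → p ≤ q → r * p ≤ r * q
*-monoˡ-≤ {r} 0≤r = ℚₚ.*-monoˡ-≤-nonNeg r {{ℚ.nonNegative 0≤r}}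

*-monoʳ-≤ : ∀ {r p q} → 0ℚ ≤ r → p ≤ q → p * r ≤ q * r
*-monoʳ-≤ {r} 0≤r = ℚₚ.*-monoʳ-≤-nonNeg r {{ℚ.nonNegative 0≤r}}

*-mono-≤ : ∀ {p q r s} → 0ℚ ≤ p → 0ℚ ≤ s → p ≤ q → r ≤ s → p * r ≤ q * s
*-mono-≤ 0≤p 0≤s p≤q r≤s = ≤-trans (*-monoˡ-≤ 0≤p r≤s) (*-monoʳ-≤ 0≤s p≤q)

*-cancelˡ-≤ : ∀ {r p q} → 0ℚ < r → r * p ≤ r * q → p ≤ q
*-cancelˡ-≤ {r} 0<r = ℚₚ.*-cancelˡ-≤-pos r {{ℚ.positive 0<r}}

p≤p+q : ∀ {p q} → 0ℚ ≤ q → p ≤ p + q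
p≤p+q {p} 0≤q = ≤-trans (≤-reflexive (sym (ℚₚ.+-identityʳ p))) (+-monoʳ-≤ p 0≤q)

+-cancelʳ-≤ : ∀ {p q r} → p + r ≤ q + r → p ≤ q
+-cancelʳ-≤ {p} {q} {r} le =
  ≤-trans (≤-reflexive (add-sub p r)) (≤-trans (+-monoˡ-≤ (- r) le) (≤-reflexive (sym (add-sub q r))))
  where
  add-sub : ∀ x y → x ≡ x + y + - y
  add-sub = solve 2 (λ x y → x := x :+ y :+ :- y) refl

0≤1 : 0ℚ ≤ 1ℚ
0≤1 = <⇒≤ (ℚₚ.positive⁻¹ 1ℚ)

^ℚ-nonNeg : ∀ {x} j → 0ℚ ≤ x → 0ℚ ≤ x ^ℚ j
^ℚ-nonNeg zero    0≤x = 0≤1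
^ℚ-nonNeg (suc j) 0≤x = *-nonNeg 0≤x (^ℚ-nonNeg j 0≤x)

^ℚ-pos : ∀ {x} j → 0ℚ < x → 0ℚ < x ^ℚ j
^ℚ-pos zero    0<x = ℚₚ.positive⁻¹ 1ℚ
^ℚ-pos (suc j) 0<x = *-pos 0<x (^ℚ-pos j 0<x)

^ℚ-distribˡ-+-* : ∀ x i j → x ^ℚ (i ℕ.+ j) ≡ x ^ℚ i * x ^ℚ j
^ℚ-distribˡ-+-* x zero    j = sym (ℚₚ.*-identityˡ _)
^ℚ-distribˡ-+-* x (suc i) j = trans (cong (x *_) (^ℚ-distribˡ-+-* x i j)) (sym (ℚₚ.*-assoc x _ _))

^ℚ-distrib-* : ∀ x y j → (x * y) ^ℚ j ≡ x ^ℚ j * y ^ℚ j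
^ℚ-distrib-* x y zero    = refl
^ℚ-distrib-* x y (suc j) rewrite ^ℚ-distrib-* x y j = interchange x y (x ^ℚ j) (y ^ℚ j)
  where
  interchange : ∀ a b c d → a * b * (c * d) ≡ a * c * (b * d)
  interchange = solve 4 (λ a b c d → a :* b :* (c :* d) := a :* c :* (b :* d)) refl

^ℚ-*-assoc : ∀ x i j → (x ^ℚ i) ^ℚ j ≡ x ^ℚ (i ℕ.* j)
^ℚ-*-assoc x i zero    rewrite ℕₚ.*-zeroʳ i = refl
^ℚ-*-assoc x i (suc j) rewrite ℕₚ.*-suc i j =
  trans (cong (x ^ℚ i *_) (^ℚ-*-assoc x i j)) (sym (^ℚ-distribˡ-+-* x i (i ℕ.* j)))

^ℚ-inverse : ∀ x y j → x * y ≡ 1ℚ → x ^ℚ j * y ^ℚ j ≡ 1ℚ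
^ℚ-inverse x y zero    xy≡1 = refl
^ℚ-inverse x y (suc j) xy≡1 =
  trans (sym (^ℚ-distrib-* x y (suc j))) (trans (cong (_^ℚ suc j) xy≡1) (1^ℚ (suc j)))
  where
  1^ℚ : ∀ i → 1ℚ ^ℚ i ≡ 1ℚ
  1^ℚ zero    = refl
  1^ℚ (suc i) = cong (1ℚ *_) (1^ℚ i)

^ℚ-monoʳ-≤ : ∀ {x} → 1ℚ ≤ x → ∀ {i j} → i ℕ.≤ j → x ^ℚ i ≤ x ^ℚ j
^ℚ-monoʳ-≤ {x} 1≤x {zero}  {zero}  z≤n       = ≤-refl
^ℚ-monoʳ-≤ {x} 1≤x {zero}  {suc j} z≤n       =
  ≤-trans (^ℚ-monoʳ-≤ 1≤x {zero} {j} z≤n)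
          (≤-trans (≤-reflexive (sym (ℚₚ.*-identityˡ _))) (*-monoʳ-≤ (^ℚ-nonNeg j (≤-trans 0≤1 1≤x)) 1≤x))
^ℚ-monoʳ-≤ {x} 1≤x {suc i} {suc j} (s≤s i≤j) = *-monoˡ-≤ (≤-trans 0≤1 1≤x) (^ℚ-monoʳ-≤ 1≤x i≤j)

^ℚ-antimonoʳ-≤ : ∀ {x} → 0ℚ ≤ x → x ≤ 1ℚ → ∀ {i j} → i ℕ.≤ j → x ^ℚ j ≤ x ^ℚ i
^ℚ-antimonoʳ-≤ 0≤x x≤1 {zero}  {zero}  z≤n       = ≤-refl
^ℚ-antimonoʳ-≤ 0≤x x≤1 {zero}  {suc j} z≤n       =
  *-mono-≤ 0≤x 0≤1 x≤1 (^ℚ-antimonoʳ-≤ 0≤x x≤1 {zero} {j} z≤n)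
^ℚ-antimonoʳ-≤ 0≤x x≤1 {suc i} {suc j} (s≤s i≤j) = *-monoˡ-≤ 0≤x (^ℚ-antimonoʳ-≤ 0≤x x≤1 i≤j)

[]ℚ-homo-^ : ∀ m j → [ m ℕ.^ j ]ℚ ≡ [ m ]ℚ ^ℚ j
[]ℚ-homo-^ m zero    = refl
[]ℚ-homo-^ m (suc j) = trans ([]ℚ-homo-* m (m ℕ.^ j)) (cong ([ m ]ℚ *_) ([]ℚ-homo-^ m j))

module ListSum (M : CommutativeMonoid 0ℓ 0ℓ) where

  open CommutativeMonoid M
    using (Carrier; _≈_; _∙_; ε; ∙-cong; ∙-congˡ; identityˡ; commutativeSemigroup)
    renaming (refl to ≈-refl; sym to ≈-sym; trans to ≈-trans)
  open import Algebra.Properties.CommutativeSemigroup commutativeSemigroup using (interchange)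

  ∑ : {A : Set} → List A → (A → Carrier) → Carrier
  ∑ []       f = ε
  ∑ (x ∷ xs) f = f x ∙ ∑ xs f

  module _ {A : Set} where

    ∑-cong : ∀ (xs : List A) {f g} → (∀ x → f x ≈ g x) → ∑ xs f ≈ ∑ xs g
    ∑-cong []       f≈g = ≈-refl
    ∑-cong (x ∷ xs) f≈g = ∙-cong (f≈g x) (∑-cong xs f≈g)

    ∑-distrib-∙ : ∀ (xs : List A) f g → ∑ xs (λ x → f x ∙ g x) ≈ ∑ xs f ∙ ∑ xs g
    ∑-distrib-∙ []       f g = ≈-sym (identityˡ ε)
    ∑-distrib-∙ (x ∷ xs) f g =
      ≈-trans (∙-congˡ (∑-distrib-∙ xs f g)) (interchange (f x) (g x) (∑ xs f) (∑ xs g))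

    ∑-ε : ∀ (xs : List A) → ∑ xs (λ _ → ε) ≈ ε
    ∑-ε []       = ≈-refl
    ∑-ε (x ∷ xs) = ≈-trans (identityˡ _) (∑-ε xs)

    ∑-filterᵇ : ∀ (p : A → Bool) xs f → ∑ (filterᵇ p xs) f ≈ ∑ xs (λ x → if p x then f x else ε)
    ∑-filterᵇ p []       f = ≈-refl
    ∑-filterᵇ p (x ∷ xs) f with p x
    ... | true  = ∙-congˡ (∑-filterᵇ p xs f)
    ... | false = ≈-trans (∑-filterᵇ p xs f) (≈-sym (identityˡ _))

    ∑-map : ∀ {B : Set} (g : B → A) xs f → ∑ (map g xs) f ≈ ∑ xs (f ∘ g)
    ∑-map g []       f = ≈-refl
    ∑-map g (x ∷ xs) f = ∙-congˡ (∑-map g xs f)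

  ∑-comm : ∀ {A B : Set} (xs : List A) (ys : List B) (f : A → B → Carrier) →
           ∑ xs (λ x → ∑ ys (f x)) ≈ ∑ ys (λ y → ∑ xs (λ x → f x y))
  ∑-comm []       ys f = ≈-sym (∑-ε ys)
  ∑-comm (x ∷ xs) ys f =
    ≈-trans (∙-congˡ (∑-comm xs ys f)) (≈-sym (∑-distrib-∙ ys (f x) (λ y → ∑ xs (λ x′ → f x′ y))))

module ℕΣ = ListSum ℕₚ.+-0-commutativeMonoid
module ℚΣ = ListSum ℚₚ.+-0-commutativeMonoid

filterᵇ-∧ : ∀ {A : Set} (p q : A → Bool) xs → filterᵇ p (filterᵇ q xs) ≡ filterᵇ (λ x → q x ∧ p x) xs
filterᵇ-∧ p q []       = refl
filterᵇ-∧ p q (x ∷ xs) with q x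
... | false = filterᵇ-∧ p q xs
... | true with p x
...   | true  = cong (x ∷_) (filterᵇ-∧ p q xs)
...   | false = filterᵇ-∧ p q xs

filterᵇ-comm : ∀ {A : Set} (p q : A → Bool) xs → filterᵇ p (filterᵇ q xs) ≡ filterᵇ q (filterᵇ p xs)
filterᵇ-comm p q []       = refl
filterᵇ-comm p q (x ∷ xs) with q x in qx | p x in px
... | true  | true  rewrite px | qx = cong (x ∷_) (filterᵇ-comm p q xs)
... | true  | false rewrite px = filterᵇ-comm p q xs
... | false | true  rewrite qx = filterᵇ-comm p q xs
... | false | false = filterᵇ-comm p q xs

filterᵇ-true : ∀ {A : Set} (xs : List A) → filterᵇ (λ _ → true) xs ≡ xs
filterᵇ-true []       = refl
filterᵇ-true (x ∷ xs) = cong (x ∷_) (filterᵇ-true xs)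

χ : Bool → ℕ
χ b = if b then 1 else 0

∑-const-1 : ∀ {A : Set} (xs : List A) → ℕΣ.∑ xs (λ _ → 1) ≡ length xs
∑-const-1 []       = refl
∑-const-1 (x ∷ xs) = cong suc (∑-const-1 xs)

length-filterᵇ : ∀ {A : Set} (p : A → Bool) xs → length (filterᵇ p xs) ≡ ℕΣ.∑ xs (χ ∘ p)
length-filterᵇ p xs = trans (sym (∑-const-1 (filterᵇ p xs))) (ℕΣ.∑-filterᵇ p xs (λ _ → 1))

sum-map : ∀ {A : Set} (f : A → ℕ) xs → sum (map f xs) ≡ ℕΣ.∑ xs f
sum-map f []       = refl
sum-map f (x ∷ xs) = cong (f x ℕ.+_) (sum-map f xs)

∑-allFin-suc : ∀ n (f : Fin (suc n) → ℕ) →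
               ℕΣ.∑ (allFin (suc n)) f ≡ f Fin.zero ℕ.+ ℕΣ.∑ (allFin n) (f ∘ Fin.suc)
∑-allFin-suc n f = cong (f Fin.zero ℕ.+_)
  (trans (cong (λ xs → ℕΣ.∑ xs f) (sym (Listₚ.map-tabulate id Fin.suc))) (ℕΣ.∑-map Fin.suc (allFin n) f))

∑-[]ℚ : ∀ {A : Set} (xs : List A) (f : A → ℕ) → ℚΣ.∑ xs (λ x → [ f x ]ℚ) ≡ [ ℕΣ.∑ xs f ]ℚ
∑-[]ℚ []       f = refl
∑-[]ℚ (x ∷ xs) f = trans (cong (_+_ [ f x ]ℚ) (∑-[]ℚ xs f)) (sym ([]ℚ-homo-+ (f x) (ℕΣ.∑ xs f)))

∑-*ˡ : ∀ {A : Set} (xs : List A) c f → ℚΣ.∑ xs (λ x → c * f x) ≡ c * ℚΣ.∑ xs f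
∑-*ˡ []       c f = sym (ℚₚ.*-zeroʳ c)
∑-*ˡ (x ∷ xs) c f = trans (cong (_+_ (c * f x)) (∑-*ˡ xs c f)) (sym (ℚₚ.*-distribˡ-+ c (f x) (ℚΣ.∑ xs f)))

∑-*ʳ : ∀ {A : Set} (xs : List A) c f → ℚΣ.∑ xs (λ x → f x * c) ≡ ℚΣ.∑ xs f * c
∑-*ʳ []       c f = sym (ℚₚ.*-zeroˡ c)
∑-*ʳ (x ∷ xs) c f = trans (cong (_+_ (f x * c)) (∑-*ʳ xs c f)) (sym (ℚₚ.*-distribʳ-+ c (f x) (ℚΣ.∑ xs f)))

∑-const : ∀ {A : Set} (xs : List A) c → ℚΣ.∑ xs (λ _ → c) ≡ [ length xs ]ℚ * c
∑-const []       c = sym (ℚₚ.*-zeroˡ c)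
∑-const (x ∷ xs) c = trans (cong (_+_ c) (∑-const xs c))
  (trans (distrib c [ length xs ]ℚ) (cong (_* c) (sym ([]ℚ-homo-+ 1 (length xs)))))
  where
  distrib : ∀ c l → c + l * c ≡ (1ℚ + l) * c
  distrib = solve 2 (λ c l → c :+ l :* c := (con 1ℚ :+ l) :* c) refl

∑-mono-≤ : ∀ {A : Set} (xs : List A) {f g} → (∀ x → f x ≤ g x) → ℚΣ.∑ xs f ≤ ℚΣ.∑ xs g
∑-mono-≤ []       f≤g = ≤-refl
∑-mono-≤ (x ∷ xs) f≤g = +-mono-≤ (f≤g x) (∑-mono-≤ xs f≤g)

-- Degrees and density

_<ᶠ_ : ∀ {n} → Fin n → Fin n → Bool
u <ᶠ v = ⌊ toℕ u ℕ.<? toℕ v ⌋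

χ-split : ∀ {n} (Q : Fin n → Fin n → Bool) → (∀ u → Q u u ≡ false) →
          ∀ u v → χ (Q u v) ≡ χ (u <ᶠ v ∧ Q u v) ℕ.+ χ (v <ᶠ u ∧ Q u v)
χ-split Q irrefl u v with Q u v in Quv
... | false rewrite ∧-zeroʳ (u <ᶠ v) | ∧-zeroʳ (v <ᶠ u) = refl
... | true with toℕ u ℕ.<? toℕ v | toℕ v ℕ.<? toℕ u
...   | yes u<v | yes v<u = ⊥-elim (ℕₚ.<-asym u<v v<u)
...   | yes _   | no _    = refl
...   | no _    | yes _   = refl
...   | no u≮v  | no v≮u  with Finₚ.toℕ-injective (ℕₚ.≤-antisym (ℕₚ.≮⇒≥ v≮u) (ℕₚ.≮⇒≥ u≮v))
...     | refl with trans (sym Quv) (irrefl u)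
...       | ()

∑∑-symmetric : ∀ {n} (xs : List (Fin n)) (Q : Fin n → Fin n → Bool) →
               (∀ u v → Q u v ≡ Q v u) → (∀ u → Q u u ≡ false) →
               ℕΣ.∑ xs (λ u → ℕΣ.∑ xs (λ v → χ (Q u v))) ≡
               2 ℕ.* ℕΣ.∑ xs (λ u → ℕΣ.∑ xs (λ v → χ (u <ᶠ v ∧ Q u v)))
∑∑-symmetric xs Q sym-Q irrefl = begin
    ℕΣ.∑ xs (λ u → ℕΣ.∑ xs (λ v → χ (Q u v)))
  ≡⟨ ℕΣ.∑-cong xs (λ u → trans (ℕΣ.∑-cong xs (χ-split Q irrefl u)) (ℕΣ.∑-distrib-∙ xs _ _)) ⟩
    ℕΣ.∑ xs (λ u → A u ℕ.+ B u)
  ≡⟨ ℕΣ.∑-distrib-∙ xs A B ⟩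
    ℕΣ.∑ xs A ℕ.+ ℕΣ.∑ xs B
  ≡⟨ cong (ℕΣ.∑ xs A ℕ.+_) ∑B≡∑A ⟩
    ℕΣ.∑ xs A ℕ.+ ℕΣ.∑ xs A
  ≡⟨ cong (ℕΣ.∑ xs A ℕ.+_) (sym (ℕₚ.+-identityʳ _)) ⟩
    2 ℕ.* ℕΣ.∑ xs A
  ∎
  where
  open ≡-Reasoning
  A B : Fin _ → ℕ
  A u = ℕΣ.∑ xs (λ v → χ (u <ᶠ v ∧ Q u v))
  B u = ℕΣ.∑ xs (λ v → χ (v <ᶠ u ∧ Q u v))
  ∑B≡∑A : ℕΣ.∑ xs B ≡ ℕΣ.∑ xs A
  ∑B≡∑A = trans (ℕΣ.∑-comm xs xs (λ u v → χ (v <ᶠ u ∧ Q u v)))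
                (ℕΣ.∑-cong xs (λ v → ℕΣ.∑-cong xs (λ u → cong (λ b → χ (v <ᶠ u ∧ b)) (sym-Q u v))))

module Degrees {n : ℕ} (Γ : Graph n) where

  members : (Fin n → Bool) → List (Fin n)
  members P = filterᵇ P (allFin n)

  members-unique : ∀ P → Unique (members P)
  members-unique P = Uniqueₚ.filter⁺ (Bool.T? ∘ P) {xs = allFin n} (Uniqueₚ.allFin⁺ n)

  degreeIn : List (Fin n) → Fin n → ℕ
  degreeIn S v = length (filterᵇ (adj Γ v) S)

  ∣tabulate∣≡length-members : ∀ P → ∣ Vec.tabulate P ∣ ≡ length (members P)
  ∣tabulate∣≡length-members P = trans (∣tabulate∣ P) (sym (length-filterᵇ P (allFin n)))
    where
    ∣tabulate∣ : ∀ {m} (R : Fin m → Bool) → ∣ Vec.tabulate R ∣ ≡ ℕΣ.∑ (allFin m) (χ ∘ R)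
    ∣tabulate∣ {zero}  R = refl
    ∣tabulate∣ {suc m} R rewrite ∑-allFin-suc m (χ ∘ R) with R Fin.zero
    ... | true  = cong suc (∣tabulate∣ (R ∘ Fin.suc))
    ... | false = ∣tabulate∣ (R ∘ Fin.suc)

  inducedAdj : (Fin n → Bool) → Fin n → Fin n → Bool
  inducedAdj P u v = P u ∧ (P v ∧ adj Γ u v)

  edgesIn-tabulate : ∀ P → edgesIn Γ (Vec.tabulate P) ≡
    ℕΣ.∑ (allFin n) (λ u → ℕΣ.∑ (allFin n) (λ v → χ (u <ᶠ v ∧ inducedAdj P u v)))
  edgesIn-tabulate P = trans (sum-map _ (allFin n)) (ℕΣ.∑-cong (allFin n) (λ u →
    trans (sum-map _ (allFin n)) (ℕΣ.∑-cong (allFin n) (λ v →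
      cong₂ (λ x y → χ (u <ᶠ v ∧ (x ∧ (y ∧ adj Γ u v))))
            (Vecₚ.lookup∘tabulate P u) (Vecₚ.lookup∘tabulate P v)))))

  degree-as-sum : ∀ P v → (if P v then degreeIn (members P) v else 0) ≡
                          ℕΣ.∑ (allFin n) (λ u → χ (inducedAdj P v u))
  degree-as-sum P v with P v
  ... | false = sym (ℕΣ.∑-ε (allFin n))
  ... | true  = trans (length-filterᵇ (adj Γ v) (members P))
                  (trans (ℕΣ.∑-filterᵇ P (allFin n) _) (ℕΣ.∑-cong (allFin n) χ-∧))
    where
    χ-∧ : ∀ u → (if P u then χ (adj Γ v u) else 0) ≡ χ (P u ∧ adj Γ v u)
    χ-∧ u with P u
    ... | true  = refl
    ... | false = refl

  inducedAdj-sym : ∀ P u v → inducedAdj P u v ≡ inducedAdj P v u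
  inducedAdj-sym P u v rewrite Graph.sym Γ u v with P u | P v
  ... | true  | true  = refl
  ... | true  | false = refl
  ... | false | true  = refl
  ... | false | false = refl

  inducedAdj-irrefl : ∀ P u → inducedAdj P u u ≡ false
  inducedAdj-irrefl P u rewrite Graph.irrefl Γ u with P u
  ... | true  = refl
  ... | false = refl

  handshake : ∀ P → ℕΣ.∑ (members P) (degreeIn (members P)) ≡ 2 ℕ.* edgesIn Γ (Vec.tabulate P)
  handshake P = begin
      ℕΣ.∑ (members P) (degreeIn (members P))
    ≡⟨ ℕΣ.∑-filterᵇ P (allFin n) _ ⟩
      ℕΣ.∑ (allFin n) (λ v → if P v then degreeIn (members P) v else 0)
    ≡⟨ ℕΣ.∑-cong (allFin n) (degree-as-sum P) ⟩
      ℕΣ.∑ (allFin n) (λ v → ℕΣ.∑ (allFin n) (λ u → χ (inducedAdj P v u)))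
    ≡⟨ ∑∑-symmetric (allFin n) (inducedAdj P) (inducedAdj-sym P) (inducedAdj-irrefl P) ⟩
      2 ℕ.* ℕΣ.∑ (allFin n) (λ u → ℕΣ.∑ (allFin n) (λ v → χ (u <ᶠ v ∧ inducedAdj P u v)))
    ≡⟨ cong (2 ℕ.*_) (sym (edgesIn-tabulate P)) ⟩
      2 ℕ.* edgesIn Γ (Vec.tabulate P)
    ∎
    where open ≡-Reasoning

  dense⇒degreeSum : ∀ {ρ d} → Dense ρ d Γ → ∀ P → ρ * [ n ]ℚ ≤ [ length (members P) ]ℚ →
    d * ([ length (members P) ]ℚ * [ length (members P) ]ℚ) ≤ [ ℕΣ.∑ (members P) (degreeIn (members P)) ]ℚ
  dense⇒degreeSum {ρ} {d} dense P ρn≤m = begin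
      d * ([ m ]ℚ * [ m ]ℚ)
    ≡⟨ cong (d *_) (sym ([]ℚ-homo-* m m)) ⟩
      d * [ m ℕ.* m ]ℚ
    ≡⟨ halve (d * [ m ℕ.* m ]ℚ) ⟩
      [ 2 ]ℚ * (d * [ m ℕ.* m ]ℚ * (+ 1 / 2))
    ≤⟨ *-monoˡ-≤ ([]ℚ-nonNeg 2) edges ⟩
      [ 2 ]ℚ * [ edgesIn Γ S ]ℚ
    ≡⟨ sym ([]ℚ-homo-* 2 (edgesIn Γ S)) ⟩
      [ 2 ℕ.* edgesIn Γ S ]ℚ
    ≡⟨ cong [_]ℚ (sym (handshake P)) ⟩
      [ ℕΣ.∑ (members P) (degreeIn (members P)) ]ℚ
    ∎
    where
    open ℚₚ.≤-Reasoning
    S : Vec.Vec Bool n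
    S = Vec.tabulate P
    m : ℕ
    m = length (members P)
    halve : ∀ x → x ≡ [ 2 ]ℚ * (x * (+ 1 / 2))
    halve = solve 1 (λ x → x := con [ 2 ]ℚ :* (x :* con (+ 1 / 2))) refl
    ∣S∣≡m : ∣ S ∣ ≡ m
    ∣S∣≡m = ∣tabulate∣≡length-members P
    edges : d * [ m ℕ.* m ]ℚ * (+ 1 / 2) ≤ [ edgesIn Γ S ]ℚ
    edges = subst (λ x → d * [ x ℕ.* x ]ℚ * (+ 1 / 2) ≤ [ edgesIn Γ S ]ℚ) ∣S∣≡m
              (dense S (subst (λ x → ρ * [ n ]ℚ ≤ [ x ]ℚ) (sym ∣S∣≡m) ρn≤m))

-- Monochromatic cliques

module Cliques {n : ℕ} (Γ : Graph n) (c : TwoColouring Γ) where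

  edge : Bool → Fin n → Fin n → Bool
  edge β u v = adj Γ u v ∧ ⌊ col c u v Bool.≟ β ⌋

  edge-sym : ∀ β u v → edge β u v ≡ edge β v u
  edge-sym β u v = cong₂ (λ a γ → a ∧ ⌊ γ Bool.≟ β ⌋) (Graph.sym Γ u v) (colSym c u v)

  edge-irrefl : ∀ β v → edge β v v ≡ false
  edge-irrefl β v rewrite Graph.irrefl Γ v = refl

  edge⇒adj : ∀ β u v → edge β u v ≡ true → adj Γ u v ≡ true
  edge⇒adj β u v e with adj Γ u v
  ... | true = refl

  edge⇒colour : ∀ β u v → edge β u v ≡ true → col c u v ≡ β
  edge⇒colour β u v e with adj Γ u v | col c u v Bool.≟ β
  ... | true | yes colour≡β = colour≡β

  nbhd : Bool → Fin n → List (Fin n) → List (Fin n)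
  nbhd β v S = filterᵇ (edge β v) S

  nbhd-⊆ : ∀ β v S → nbhd β v S ⊆ S
  nbhd-⊆ β v S = filter-⊆ (Bool.T? ∘ edge β v) S

  nbhd⁺ : ∀ β v {T S} → T ⊆ S → nbhd β v T ⊆ nbhd β v S
  nbhd⁺ β v = filter⁺ (Bool.T? ∘ edge β v) (Bool.T? ∘ edge β v) (subst (T ∘ edge β v))

  degree-split : ∀ β v S → length (nbhd β v S) ℕ.+ length (nbhd (not β) v S) ≡ length (filterᵇ (adj Γ v) S)
  degree-split β v []       = refl
  degree-split β v (x ∷ S) with adj Γ v x | col c v x | degree-split β v S
  ... | false | _     | split = split
  ... | true  | true  | split with β
  ...   | true  = cong suc split
  ...   | false = trans (ℕₚ.+-suc _ _) (cong suc split)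
  degree-split β v (x ∷ S) | true | false | split with β
  ...   | true  = trans (ℕₚ.+-suc _ _) (cong suc split)
  ...   | false = cong suc split

  #cliques : Bool → ℕ → List (Fin n) → ℕ
  #cliques β zero    S       = 1
  #cliques β (suc a) []      = 0
  #cliques β (suc a) (v ∷ S) = #cliques β (suc a) S ℕ.+ #cliques β a (nbhd β v S)

  #cliques-1 : ∀ β S → #cliques β 1 S ≡ length S
  #cliques-1 β []      = refl
  #cliques-1 β (v ∷ S) = trans (ℕₚ.+-comm (#cliques β 1 S) 1) (cong suc (#cliques-1 β S))

  #cliques-mono : ∀ β a {T S} → T ⊆ S → #cliques β a T ℕ.≤ #cliques β a S
  #cliques-mono β zero    _             = ℕₚ.≤-refl
  #cliques-mono β (suc a) []            = ℕₚ.≤-refl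
  #cliques-mono β (suc a) (y ∷ʳ T⊆S)    = ℕₚ.≤-trans (#cliques-mono β (suc a) T⊆S) (ℕₚ.m≤m+n _ _)
  #cliques-mono β (suc a) (refl ∷ T⊆S) =
    ℕₚ.+-mono-≤ (#cliques-mono β (suc a) T⊆S) (#cliques-mono β a (nbhd⁺ β _ T⊆S))

  #cliques-nbhd-∷ : ∀ β a w v S → #cliques β (suc a) (nbhd β v (w ∷ S)) ≡
    #cliques β (suc a) (nbhd β v S) ℕ.+ (if edge β w v then #cliques β a (nbhd β w (nbhd β v S)) else 0)
  #cliques-nbhd-∷ β a w v S rewrite edge-sym β w v with edge β v w
  ... | true  = refl
  ... | false = sym (ℕₚ.+-identityʳ _)

  #cliques-handshake : ∀ β a S → suc a ℕ.* #cliques β (suc a) S ≡ ℕΣ.∑ S (λ v → #cliques β a (nbhd β v S))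
  #cliques-handshake β zero    S       =
    trans (ℕₚ.+-identityʳ _) (trans (#cliques-1 β S) (sym (∑-const-1 S)))
  #cliques-handshake β (suc a) []      = ℕₚ.*-zeroʳ (suc (suc a))
  #cliques-handshake β (suc a) (w ∷ S) = sym (begin
      ℕΣ.∑ (w ∷ S) (λ v → #cliques β (suc a) (nbhd β v (w ∷ S)))
    ≡⟨ cong₂ ℕ._+_ nbhd-w
             (trans (ℕΣ.∑-cong S (λ v → #cliques-nbhd-∷ β a w v S)) (ℕΣ.∑-distrib-∙ S _ _)) ⟩
      #cliques β (suc a) N ℕ.+ (ℕΣ.∑ S (λ v → #cliques β (suc a) (nbhd β v S)) ℕ.+ common)
    ≡⟨ cong₂ (λ x y → #cliques β (suc a) N ℕ.+ (x ℕ.+ y)) (sym (#cliques-handshake β (suc a) S)) common≡ ⟩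
      #cliques β (suc a) N ℕ.+ (suc (suc a) ℕ.* #cliques β (suc (suc a)) S ℕ.+ suc a ℕ.* #cliques β (suc a) N)
    ≡⟨ collect (#cliques β (suc a) N) (#cliques β (suc (suc a)) S) a ⟩
      suc (suc a) ℕ.* (#cliques β (suc (suc a)) S ℕ.+ #cliques β (suc a) N)
    ∎)
    where
    open ≡-Reasoning
    collect : ∀ x y a → x ℕ.+ (suc (suc a) ℕ.* y ℕ.+ suc a ℕ.* x) ≡ suc (suc a) ℕ.* (y ℕ.+ x)
    collect = solve-∀
    N : List (Fin n)
    N = nbhd β w S
    nbhd-w : #cliques β (suc a) (nbhd β w (w ∷ S)) ≡ #cliques β (suc a) N
    nbhd-w rewrite edge-irrefl β w = refl
    common : ℕ
    common = ℕΣ.∑ S (λ v → if edge β w v then #cliques β a (nbhd β w (nbhd β v S)) else 0)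
    common≡ : common ≡ suc a ℕ.* #cliques β (suc a) N
    common≡ = begin
        common
      ≡⟨ ℕΣ.∑-cong S (λ v → cong (λ X → if edge β w v then #cliques β a X else 0)
                                  (filterᵇ-comm (edge β w) (edge β v) S)) ⟩
        ℕΣ.∑ S (λ v → if edge β w v then #cliques β a (nbhd β v N) else 0)
      ≡⟨ sym (ℕΣ.∑-filterᵇ (edge β w) S _) ⟩
        ℕΣ.∑ N (λ v → #cliques β a (nbhd β v N))
      ≡⟨ sym (#cliques-handshake β a N) ⟩
        suc a ℕ.* #cliques β (suc a) N
      ∎

-- The supersaturation bound

½ : ℚ
½ = + 1 / 2

0≤½ : 0ℚ ≤ ½
0≤½ = <⇒≤ (ℚₚ.positive⁻¹ ½)

drop-middle : ∀ {x y z w} → 0ℚ ≤ y → 0ℚ ≤ z → x + w ≤ (x + y) + (z + w)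
drop-middle {x} {y} {z} {w} 0≤y 0≤z =
  ≤-trans (p≤p+q (+-nonNeg 0≤y 0≤z))
          (≤-reflexive (solve 4 (λ x y z w → x :+ w :+ (y :+ z) := x :+ y :+ (z :+ w)) refl x y z w))

drop-outer : ∀ {x y z w} → 0ℚ ≤ x → 0ℚ ≤ w → y + z ≤ (x + y) + (z + w)
drop-outer {x} {y} {z} {w} 0≤x 0≤w =
  ≤-trans (p≤p+q (+-nonNeg 0≤x 0≤w))
          (≤-reflexive (solve 4 (λ x y z w → y :+ z :+ (x :+ w) := x :+ y :+ (z :+ w)) refl x y z w))

-- The last hypothesis is the sum over m vertices of c·s·deg v ≤ s·m·X v + c·d/2. As G ≥ d·m² and
-- s·m ≥ 1, the total allowance m·c·d/2 is at most half of c·s·G, which leaves c·d/2 ≤ K·Y.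
averaging : ∀ {s m c e d K G σ Y} → 0ℚ < s → 0ℚ < m → 1ℚ ≤ s * m → 0ℚ ≤ c → 0ℚ ≤ d → 0ℚ < K →
  e * K ≤ d * ½ → d * (m * m) ≤ G → σ ≤ m * (K * Y) →
  c * (s * G) ≤ s * m * σ + m * (c * (d * ½)) → e * c ≤ Y
averaging {s} {m} {c} {e} {d} {K} {G} {σ} {Y} 0<s 0<m 1≤sm 0≤c 0≤d 0<K eK≤d/2 dm²≤G σ≤ sum≤ =
  *-cancelˡ-≤ 0<K (begin
    K * (e * c)   ≡⟨ solve 3 (λ K e c → K :* (e :* c) := c :* (e :* K)) refl K e c ⟩
    c * (e * K)   ≤⟨ *-monoˡ-≤ 0≤c eK≤d/2 ⟩
    w             ≤⟨ w≤KY ⟩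
    K * Y         ∎)
  where
  open ℚₚ.≤-Reasoning
  w A : ℚ
  w = c * (d * ½)
  A = s * m * m
  0≤s : 0ℚ ≤ s
  0≤s = <⇒≤ 0<s
  0≤m : 0ℚ ≤ m
  0≤m = <⇒≤ 0<m
  0≤mw : 0ℚ ≤ m * w
  0≤mw = *-nonNeg 0≤m (*-nonNeg 0≤c (*-nonNeg 0≤d 0≤½))
  w≤KY : w ≤ K * Y
  w≤KY = *-cancelˡ-≤ (*-pos (*-pos 0<s 0<m) 0<m) (+-cancelʳ-≤ (begin
      A * w + A * w
    ≡⟨ solve 4 (λ s m c d → s :* m :* m :* (c :* (d :* con ½)) :+ s :* m :* m :* (c :* (d :* con ½))
                            := c :* (s :* (d :* (m :* m)))) refl s m c d ⟩
      c * (s * (d * (m * m)))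
    ≤⟨ *-monoˡ-≤ 0≤c (*-monoˡ-≤ 0≤s dm²≤G) ⟩
      c * (s * G)
    ≤⟨ sum≤ ⟩
      s * m * σ + m * w
    ≤⟨ +-mono-≤ (*-monoˡ-≤ (*-nonNeg 0≤s 0≤m) σ≤)
                (≤-trans (≤-reflexive (sym (ℚₚ.*-identityˡ (m * w)))) (*-monoʳ-≤ 0≤mw 1≤sm)) ⟩
      s * m * (m * (K * Y)) + s * m * (m * w)
    ≡⟨ solve 5 (λ s m K Y w → s :* m :* (m :* (K :* Y)) :+ s :* m :* (m :* w)
                            := s :* m :* m :* (K :* Y) :+ s :* m :* m :* w) refl s m K Y w ⟩
      A * (K * Y) + A * w
    ∎))

1≤s*[m]⇒0<[m] : ∀ {s} m → 1ℚ ≤ s * [ m ]ℚ → 0ℚ < [ m ]ℚ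
1≤s*[m]⇒0<[m] {s} zero    1≤s0 with []ℚ-cancel-≤ {1} {0} (≤-trans 1≤s0 (≤-reflexive (ℚₚ.*-zeroʳ s)))
... | ()
1≤s*[m]⇒0<[m]     (suc m) _    = []ℚ-pos m

majority-≤ : ∀ {x y z} → z ℕ.≤ x → y ≡ x ℕ.+ z → y ℕ.≤ 2 ℕ.* x
majority-≤ {x} {z = z} z≤x refl =
  subst (x ℕ.+ z ℕ.≤_) (cong (x ℕ.+_) (sym (ℕₚ.+-identityʳ x))) (ℕₚ.+-monoʳ-≤ x z≤x)

module Supersaturation
  {n : ℕ} (Γ : Graph n) (c : TwoColouring Γ)
  {ρ d : ℚ} (dense : Dense ρ d Γ) (0≤ρ : 0ℚ ≤ ρ) (0<d : 0ℚ < d)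
  {D : ℚ} (D*d≡4 : D * d ≡ [ 4 ]ℚ) (1≤D : 1ℚ ≤ D)
  (k : ℕ) {e : ℚ} (0≤e : 0ℚ ≤ e) (e≤1 : e ≤ 1ℚ) (eK≤d/2 : e * ([ 2 ℕ.* k ]ℚ * D ^ℚ k) ≤ d * ½)
  where

  open Degrees Γ
  open Cliques Γ c

  K : ℚ
  K = [ 2 ℕ.* k ]ℚ * D ^ℚ k

  0≤D : 0ℚ ≤ D
  0≤D = ≤-trans 0≤1 1≤D

  0<D : 0ℚ < D
  0<D = <-≤-trans (ℚₚ.positive⁻¹ 1ℚ) 1≤D

  cliqueWeight : Bool → ℕ → ℕ → List (Fin n) → ℚ → ℚ
  cliqueWeight β a b S s =
    [ #cliques β (suc a) S ]ℚ * s ^ℚ suc a + [ #cliques (not β) (suc b) S ]ℚ * s ^ℚ suc b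

  -- β plays red and not β blue. The last hypothesis keeps a factor D in reserve for each of the a + b
  -- passages to a neighbourhood still to come, so every set reached has at least ρn vertices.
  Supersaturated : ℕ → ℕ → Set
  Supersaturated a b = ∀ β P {s} → 0ℚ < s → 1ℚ ≤ s * [ length (members P) ]ℚ →
    s * ρ * [ n ]ℚ * D ^ℚ (a ℕ.+ b) ≤ 1ℚ → e ^ℚ (a ℕ.+ b) ≤ cliqueWeight β a b (members P) s

  cliqueWeight-swap : ∀ β a b S s → cliqueWeight β a b S s ≡ cliqueWeight (not β) b a S s
  cliqueWeight-swap β a b S s =
    trans (ℚₚ.+-comm ([ #cliques β (suc a) S ]ℚ * s ^ℚ suc a) ([ #cliques (not β) (suc b) S ]ℚ * s ^ℚ suc b))
          (cong (λ γ → [ #cliques (not β) (suc b) S ]ℚ * s ^ℚ suc b + [ #cliques γ (suc a) S ]ℚ * s ^ℚ suc a)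
                (sym (not-involutive β)))

  supersaturated-swap : ∀ {a b} → Supersaturated a b → Supersaturated b a
  supersaturated-swap {a} {b} sat β P {s} 0<s 1≤sm hρ =
    subst₂ _≤_ (cong (e ^ℚ_) (ℕₚ.+-comm a b)) (sym (cliqueWeight-swap β b a (members P) s))
      (sat (not β) P 0<s 1≤sm (subst (λ h → s * ρ * [ n ]ℚ * D ^ℚ h ≤ 1ℚ) (ℕₚ.+-comm b a) hρ))

  supersaturated-0 : ∀ b → Supersaturated 0 b
  supersaturated-0 b β P {s} 0<s 1≤sm hρ = begin
      e ^ℚ b
    ≤⟨ ^ℚ-antimonoʳ-≤ 0≤e e≤1 {0} {b} z≤n ⟩
      1ℚ
    ≤⟨ 1≤sm ⟩
      s * [ length S ]ℚ
    ≡⟨ solve 2 (λ s x → s :* x := x :* (s :* con 1ℚ)) refl s [ length S ]ℚ ⟩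
      [ length S ]ℚ * s ^ℚ 1
    ≡⟨ cong (λ x → [ x ]ℚ * s ^ℚ 1) (sym (#cliques-1 β S)) ⟩
      [ #cliques β 1 S ]ℚ * s ^ℚ 1
    ≤⟨ p≤p+q (*-nonNeg ([]ℚ-nonNeg (#cliques (not β) (suc b) S)) (^ℚ-nonNeg (suc b) (<⇒≤ 0<s))) ⟩
      cliqueWeight β 0 b S s
    ∎
    where
    open ℚₚ.≤-Reasoning
    S : List (Fin n)
    S = members P

  coefficient-≤ : ∀ j → suc j ℕ.≤ k → [ suc j ]ℚ * D ^ℚ j + D ^ℚ suc j ≤ K
  coefficient-≤ j j<k = begin
      [ suc j ]ℚ * D ^ℚ j + D ^ℚ suc j
    ≤⟨ +-mono-≤ (*-mono-≤ ([]ℚ-nonNeg (suc j)) (^ℚ-nonNeg k 0≤D) ([]ℚ-mono-≤ j<k)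
                          (^ℚ-monoʳ-≤ 1≤D (ℕₚ.≤-trans (ℕₚ.n≤1+n j) j<k)))
                (≤-trans (^ℚ-monoʳ-≤ 1≤D j<k)
                         (≤-trans (≤-reflexive (sym (ℚₚ.*-identityˡ _)))
                                  (*-monoʳ-≤ (^ℚ-nonNeg k 0≤D)
                                             ([]ℚ-mono-≤ {1} {k} (ℕₚ.≤-trans (s≤s z≤n) j<k))))) ⟩
      [ k ]ℚ * D ^ℚ k + [ k ]ℚ * D ^ℚ k
    ≡⟨ solve 2 (λ x y → x :* y :+ x :* y := con [ 2 ]ℚ :* x :* y) refl [ k ]ℚ (D ^ℚ k) ⟩
      [ 2 ]ℚ * [ k ]ℚ * D ^ℚ k
    ≡⟨ cong (_* D ^ℚ k) (sym ([]ℚ-homo-* 2 k)) ⟩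
      K
    ∎
    where open ℚₚ.≤-Reasoning

  cliqueTerm-≤ : ∀ j x → suc j ℕ.≤ k → ∀ {s m} → 0ℚ ≤ s → 0ℚ ≤ m → 1ℚ ≤ s * m →
    [ suc j ℕ.* x ]ℚ * (D * s) ^ℚ j + m * ([ x ]ℚ * (D * s) ^ℚ suc j) ≤ m * (K * ([ x ]ℚ * s ^ℚ suc j))
  cliqueTerm-≤ j x j<k {s} {m} 0≤s 0≤m 1≤sm = begin
      [ suc j ℕ.* x ]ℚ * (D * s) ^ℚ j + m * ([ x ]ℚ * (D * s) ^ℚ suc j)
    ≡⟨ cong₂ (λ u w → u * w + m * ([ x ]ℚ * (D * s * w))) ([]ℚ-homo-* (suc j) x) (^ℚ-distrib-* D s j) ⟩
      [ suc j ]ℚ * [ x ]ℚ * (D ^ℚ j * s ^ℚ j) + m * ([ x ]ℚ * (D * s * (D ^ℚ j * s ^ℚ j)))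
    ≡⟨ solve 7 (λ r x Dj sj m D s → r :* x :* (Dj :* sj) :+ m :* (x :* (D :* s :* (Dj :* sj)))
                                    := r :* Dj :* (x :* sj) :* con 1ℚ :+ m :* (D :* Dj :* (x :* sj) :* s)) refl
               [ suc j ]ℚ [ x ]ℚ (D ^ℚ j) (s ^ℚ j) m D s ⟩
      r * xs * 1ℚ + m * (D ^ℚ suc j * xs * s)
    ≤⟨ +-monoˡ-≤ _ (*-monoˡ-≤ (*-nonNeg 0≤r 0≤xs) 1≤sm) ⟩
      r * xs * (s * m) + m * (D ^ℚ suc j * xs * s)
    ≡⟨ solve 5 (λ c xs s m D1 → c :* xs :* (s :* m) :+ m :* (D1 :* xs :* s) := m :* ((c :+ D1) :* (xs :* s))) refl
               r xs s m (D ^ℚ suc j) ⟩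
      m * ((r + D ^ℚ suc j) * (xs * s))
    ≤⟨ *-monoˡ-≤ 0≤m (*-monoʳ-≤ (*-nonNeg 0≤xs 0≤s) (coefficient-≤ j j<k)) ⟩
      m * (K * (xs * s))
    ≡⟨ cong (λ u → m * (K * u)) (solve 3 (λ x sj s → x :* sj :* s := x :* (s :* sj)) refl [ x ]ℚ (s ^ℚ j) s) ⟩
      m * (K * ([ x ]ℚ * s ^ℚ suc j))
    ∎
    where
    open ℚₚ.≤-Reasoning
    r xs : ℚ
    r = [ suc j ]ℚ * D ^ℚ j
    xs = [ x ]ℚ * s ^ℚ j
    0≤r : 0ℚ ≤ r
    0≤r = *-nonNeg ([]ℚ-nonNeg (suc j)) (^ℚ-nonNeg j 0≤D)
    0≤xs : 0ℚ ≤ xs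
    0≤xs = *-nonNeg ([]ℚ-nonNeg x) (^ℚ-nonNeg j 0≤s)

  0<K : 1 ℕ.≤ k → 0ℚ < K
  0<K 1≤k = *-pos (<-≤-trans ([]ℚ-pos 0) ([]ℚ-mono-≤ (ℕₚ.≤-trans 1≤k (ℕₚ.m≤m+n k _)))) (^ℚ-pos k 0<D)

  ρn≤size : ∀ {s x} h → 0ℚ < s → 1ℚ ≤ s * x → s * ρ * [ n ]ℚ * D ^ℚ h ≤ 1ℚ → ρ * [ n ]ℚ ≤ x
  ρn≤size {s} {x} h 0<s 1≤sx hρ = *-cancelˡ-≤ 0<s (begin
      s * (ρ * [ n ]ℚ)
    ≡⟨ solve 3 (λ s ρ N → s :* (ρ :* N) := s :* ρ :* N :* con 1ℚ) refl s ρ [ n ]ℚ ⟩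
      s * ρ * [ n ]ℚ * 1ℚ
    ≤⟨ *-monoˡ-≤ (*-nonNeg (*-nonNeg (<⇒≤ 0<s) 0≤ρ) ([]ℚ-nonNeg n)) (^ℚ-monoʳ-≤ 1≤D {0} {h} z≤n) ⟩
      s * ρ * [ n ]ℚ * D ^ℚ h
    ≤⟨ hρ ⟩
      1ℚ
    ≤⟨ 1≤sx ⟩
      s * x
    ∎)
    where open ℚₚ.≤-Reasoning

  halfDegree⇒large : ∀ {s} x y → 0ℚ ≤ s → d * ½ ≤ s * [ y ]ℚ → y ℕ.≤ 2 ℕ.* x →
                     1ℚ ≤ D * s * [ x ]ℚ
  halfDegree⇒large {s} x y 0≤s high y≤2x = begin
      1ℚ
    ≡⟨ sym (trans (solve 2 (λ D d → D :* (d :* con ½) :* con ½ := D :* d :* con (+ 1 / 4)) refl D d)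
                  (cong (_* (+ 1 / 4)) D*d≡4)) ⟩
      D * (d * ½) * ½
    ≤⟨ *-monoʳ-≤ 0≤½ (*-monoˡ-≤ 0≤D high) ⟩
      D * (s * [ y ]ℚ) * ½
    ≤⟨ *-monoʳ-≤ 0≤½ (*-monoˡ-≤ 0≤D (*-monoˡ-≤ 0≤s ([]ℚ-mono-≤ y≤2x))) ⟩
      D * (s * [ 2 ℕ.* x ]ℚ) * ½
    ≡⟨ cong (λ u → D * (s * u) * ½) ([]ℚ-homo-* 2 x) ⟩
      D * (s * ([ 2 ]ℚ * [ x ]ℚ)) * ½
    ≡⟨ solve 3 (λ D s x → D :* (s :* (con [ 2 ]ℚ :* x)) :* con ½ := D :* s :* x) refl D s [ x ]ℚ ⟩
      D * s * [ x ]ℚ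
    ∎
    where open ℚₚ.≤-Reasoning

  nbhd-bound : ∀ {p q} → Supersaturated p (suc q) → ∀ γ P v {s} → 0ℚ < s →
    d * ½ ≤ s * [ degreeIn (members P) v ]ℚ →
    length (nbhd (not γ) v (members P)) ℕ.≤ length (nbhd γ v (members P)) →
    s * ρ * [ n ]ℚ * D ^ℚ suc (p ℕ.+ suc q) ≤ 1ℚ →
    e ^ℚ (p ℕ.+ suc q) ≤ [ #cliques γ (suc p) (nbhd γ v (members P)) ]ℚ * (D * s) ^ℚ suc p
                        + [ #cliques (not γ) (suc (suc q)) (members P) ]ℚ * (D * s) ^ℚ suc (suc q)
  nbhd-bound {p} {q} sat γ P v {s} 0<s high majority hρ = begin
      e ^ℚ (p ℕ.+ suc q)
    ≤⟨ sat γ P′ (*-pos 0<D 0<s) large hρ′ ⟩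
      cliqueWeight γ p (suc q) (members P′) (D * s)
    ≡⟨ cong (λ N → cliqueWeight γ p (suc q) N (D * s)) (sym N≡members) ⟩
      cliqueWeight γ p (suc q) N (D * s)
    ≤⟨ +-monoʳ-≤ ([ #cliques γ (suc p) N ]ℚ * (D * s) ^ℚ suc p)
                 (*-monoʳ-≤ (^ℚ-nonNeg (suc (suc q)) (*-nonNeg 0≤D (<⇒≤ 0<s)))
                            ([]ℚ-mono-≤ (#cliques-mono (not γ) (suc (suc q)) (nbhd-⊆ γ v S)))) ⟩
      [ #cliques γ (suc p) N ]ℚ * (D * s) ^ℚ suc p
        + [ #cliques (not γ) (suc (suc q)) S ]ℚ * (D * s) ^ℚ suc (suc q)
    ∎
    where
    open ℚₚ.≤-Reasoning
    S N : List (Fin n)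
    S = members P
    N = nbhd γ v S
    P′ : Fin n → Bool
    P′ u = P u ∧ edge γ v u
    N≡members : N ≡ members P′
    N≡members = filterᵇ-∧ (edge γ v) P (allFin n)
    large : 1ℚ ≤ D * s * [ length (members P′) ]ℚ
    large = subst (λ M → 1ℚ ≤ D * s * [ length M ]ℚ) N≡members
      (halfDegree⇒large (length N) (degreeIn S v) (<⇒≤ 0<s) high
        (majority-≤ majority (sym (degree-split γ v S))))
    hρ′ : D * s * ρ * [ n ]ℚ * D ^ℚ (p ℕ.+ suc q) ≤ 1ℚ
    hρ′ = ≤-trans (≤-reflexive (solve 5 (λ D s ρ N Dh → D :* s :* ρ :* N :* Dh := s :* ρ :* N :* (D :* Dh)) refl
                                       D s ρ [ n ]ℚ (D ^ℚ (p ℕ.+ suc q)))) hρ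

  module Step {a b : ℕ} (a+2≤k : suc (suc a) ℕ.≤ k) (b+2≤k : suc (suc b) ℕ.≤ k)
              (sat₁ : Supersaturated a (suc b)) (sat₂ : Supersaturated b (suc a))
              (β : Bool) (P : Fin n → Bool) {s : ℚ} (0<s : 0ℚ < s)
              (1≤sm : 1ℚ ≤ s * [ length (members P) ]ℚ)
              (hρ : s * ρ * [ n ]ℚ * D ^ℚ (suc a ℕ.+ suc b) ≤ 1ℚ)
    where

    S : List (Fin n)
    S = members P

    m : ℕ
    m = length S

    s′ c₀ W : ℚ
    s′ = D * s
    c₀ = e ^ℚ (a ℕ.+ suc b)
    W = c₀ * (d * ½)

    0≤s : 0ℚ ≤ s
    0≤s = <⇒≤ 0<s
    0≤s′ : 0ℚ ≤ s′
    0≤s′ = *-nonNeg 0≤D 0≤s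
    0≤c₀ : 0ℚ ≤ c₀
    0≤c₀ = ^ℚ-nonNeg (a ℕ.+ suc b) 0≤e
    0≤W : 0ℚ ≤ W
    0≤W = *-nonNeg 0≤c₀ (*-nonNeg (<⇒≤ 0<d) 0≤½)

    weighted : ℕ → ℕ → ℚ
    weighted x j = [ x ]ℚ * s′ ^ℚ j

    0≤weighted : ∀ x j → 0ℚ ≤ weighted x j
    0≤weighted x j = *-nonNeg ([]ℚ-nonNeg x) (^ℚ-nonNeg j 0≤s′)

    term : Bool → ℕ → Fin n → ℚ
    term γ p v = weighted (#cliques γ (suc p) (nbhd γ v S)) (suc p)

    R B : ℕ
    R = #cliques β (suc (suc a)) S
    B = #cliques (not β) (suc (suc b)) S

    C : ℚ
    C = weighted R (suc (suc a)) + weighted B (suc (suc b))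

    -- For a vertex of high degree, the induction hypothesis on its larger colour class is bounded by X v,
    -- whichever colour that is.
    X : Fin n → ℚ
    X v = (term β a v + term (not β) b v) + C

    0≤term : ∀ γ p v → 0ℚ ≤ term γ p v
    0≤term γ p v = 0≤weighted (#cliques γ (suc p) (nbhd γ v S)) (suc p)

    0≤R : 0ℚ ≤ weighted R (suc (suc a))
    0≤R = 0≤weighted R (suc (suc a))

    0≤B : 0ℚ ≤ weighted B (suc (suc b))
    0≤B = 0≤weighted B (suc (suc b))

    0≤X : ∀ v → 0ℚ ≤ X v
    0≤X v = +-nonNeg (+-nonNeg (0≤term β a v) (0≤term (not β) b v)) (+-nonNeg 0≤R 0≤B)

    β-bound≤X : ∀ v → term β a v + weighted B (suc (suc b)) ≤ X v
    β-bound≤X v = drop-middle {term β a v} {term (not β) b v} {weighted R (suc (suc a))} {weighted B (suc (suc b))}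
                              (0≤term (not β) b v) 0≤R

    ¬β-bound≤X : ∀ v → term (not β) b v + weighted (#cliques (not (not β)) (suc (suc a)) S) (suc (suc a)) ≤ X v
    ¬β-bound≤X v = subst (λ γ → term (not β) b v + weighted (#cliques γ (suc (suc a)) S) (suc (suc a)) ≤ X v)
                         (sym (not-involutive β))
                         (drop-outer {term β a v} {term (not β) b v} {weighted R (suc (suc a))} {weighted B (suc (suc b))}
                                     (0≤term β a v) 0≤B)

    highDegree-bound : ∀ v → d * ½ ≤ s * [ degreeIn S v ]ℚ → c₀ ≤ X v
    highDegree-bound v high = byMajority (length (nbhd (not β) v S) ≤? length (nbhd β v S))
      where
      exponent : b ℕ.+ suc a ≡ a ℕ.+ suc b
      exponent = trans (ℕₚ.+-suc b a) (trans (cong suc (ℕₚ.+-comm b a)) (sym (ℕₚ.+-suc a b)))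
      hρ′ : s * ρ * [ n ]ℚ * D ^ℚ suc (b ℕ.+ suc a) ≤ 1ℚ
      hρ′ = subst (λ h → s * ρ * [ n ]ℚ * D ^ℚ suc h ≤ 1ℚ) (sym exponent) hρ
      byMajority : Dec (length (nbhd (not β) v S) ℕ.≤ length (nbhd β v S)) → c₀ ≤ X v
      byMajority (yes β-majority) = ≤-trans (nbhd-bound sat₁ β P v 0<s high β-majority hρ) (β-bound≤X v)
      byMajority (no ¬β-majority) =
        ≤-trans (subst (λ h → e ^ℚ h ≤ term (not β) b v
                                       + weighted (#cliques (not (not β)) (suc (suc a)) S) (suc (suc a)))
                       exponent (nbhd-bound sat₂ (not β) P v 0<s high majority hρ′))
                (¬β-bound≤X v)
        where
        majority : length (nbhd (not (not β)) v S) ℕ.≤ length (nbhd (not β) v S)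
        majority = subst (λ γ → length (nbhd γ v S) ℕ.≤ length (nbhd (not β) v S)) (sym (not-involutive β))
                         (ℕₚ.<⇒≤ (ℕₚ.≰⇒> ¬β-majority))

    vertex-≤ : ∀ v → c₀ * (s * [ degreeIn S v ]ℚ) ≤ s * [ m ]ℚ * X v + W
    vertex-≤ v = byDegree (d * ½ ℚₚ.≤? s * [ degreeIn S v ]ℚ)
      where
      byDegree : Dec (d * ½ ≤ s * [ degreeIn S v ]ℚ) → c₀ * (s * [ degreeIn S v ]ℚ) ≤ s * [ m ]ℚ * X v + W
      byDegree (yes high) = begin
          c₀ * (s * [ degreeIn S v ]ℚ)
        ≤⟨ *-monoˡ-≤ 0≤c₀ (*-monoˡ-≤ 0≤s ([]ℚ-mono-≤ (Listₚ.length-filter (Bool.T? ∘ adj Γ v) S))) ⟩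
          c₀ * (s * [ m ]ℚ)
        ≡⟨ ℚₚ.*-comm c₀ (s * [ m ]ℚ) ⟩
          s * [ m ]ℚ * c₀
        ≤⟨ *-monoˡ-≤ (*-nonNeg 0≤s ([]ℚ-nonNeg m)) (highDegree-bound v high) ⟩
          s * [ m ]ℚ * X v
        ≤⟨ p≤p+q 0≤W ⟩
          s * [ m ]ℚ * X v + W
        ∎
        where open ℚₚ.≤-Reasoning
      byDegree (no low) =
        ≤-trans (*-monoˡ-≤ 0≤c₀ (<⇒≤ (ℚₚ.≰⇒> low)))
                (≤-trans (≤-reflexive (sym (ℚₚ.+-identityˡ W)))
                         (+-monoˡ-≤ W (*-nonNeg (*-nonNeg 0≤s ([]ℚ-nonNeg m)) (0≤X v))))

    summed : c₀ * (s * [ ℕΣ.∑ S (degreeIn S) ]ℚ) ≤ s * [ m ]ℚ * ℚΣ.∑ S X + [ m ]ℚ * W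
    summed = begin
        c₀ * (s * [ ℕΣ.∑ S (degreeIn S) ]ℚ)
      ≡⟨ cong (λ u → c₀ * (s * u)) (sym (∑-[]ℚ S (degreeIn S))) ⟩
        c₀ * (s * ℚΣ.∑ S (λ v → [ degreeIn S v ]ℚ))
      ≡⟨ trans (cong (c₀ *_) (sym (∑-*ˡ S s (λ v → [ degreeIn S v ]ℚ))))
               (sym (∑-*ˡ S c₀ (λ v → s * [ degreeIn S v ]ℚ))) ⟩
        ℚΣ.∑ S (λ v → c₀ * (s * [ degreeIn S v ]ℚ))
      ≤⟨ ∑-mono-≤ S vertex-≤ ⟩
        ℚΣ.∑ S (λ v → s * [ m ]ℚ * X v + W)
      ≡⟨ trans (ℚΣ.∑-distrib-∙ S (λ v → s * [ m ]ℚ * X v) (λ _ → W))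
               (cong₂ _+_ (∑-*ˡ S (s * [ m ]ℚ) X) (∑-const S W)) ⟩
        s * [ m ]ℚ * ℚΣ.∑ S X + [ m ]ℚ * W
      ∎
      where open ℚₚ.≤-Reasoning

    ∑-term : ∀ γ p → ℚΣ.∑ S (term γ p) ≡ weighted (suc (suc p) ℕ.* #cliques γ (suc (suc p)) S) (suc p)
    ∑-term γ p = begin
        ℚΣ.∑ S (term γ p)
      ≡⟨ ∑-*ʳ S (s′ ^ℚ suc p) (λ v → [ #cliques γ (suc p) (nbhd γ v S) ]ℚ) ⟩
        ℚΣ.∑ S (λ v → [ #cliques γ (suc p) (nbhd γ v S) ]ℚ) * s′ ^ℚ suc p
      ≡⟨ cong (_* s′ ^ℚ suc p) (∑-[]ℚ S (λ v → #cliques γ (suc p) (nbhd γ v S))) ⟩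
        [ ℕΣ.∑ S (λ v → #cliques γ (suc p) (nbhd γ v S)) ]ℚ * s′ ^ℚ suc p
      ≡⟨ cong (λ x → [ x ]ℚ * s′ ^ℚ suc p) (sym (#cliques-handshake γ (suc p) S)) ⟩
        weighted (suc (suc p) ℕ.* #cliques γ (suc (suc p)) S) (suc p)
      ∎
      where open ≡-Reasoning

    ∑X-≤ : ℚΣ.∑ S X ≤ [ m ]ℚ * (K * ([ R ]ℚ * s ^ℚ suc (suc a) + [ B ]ℚ * s ^ℚ suc (suc b)))
    ∑X-≤ = begin
        ℚΣ.∑ S X
      ≡⟨ trans (ℚΣ.∑-distrib-∙ S (λ v → term β a v + term (not β) b v) (λ _ → C))
               (cong₂ _+_ (trans (ℚΣ.∑-distrib-∙ S (term β a) (term (not β) b))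
                                 (cong₂ _+_ (∑-term β a) (∑-term (not β) b)))
                          (∑-const S C)) ⟩
        (weighted (suc (suc a) ℕ.* R) (suc a) + weighted (suc (suc b) ℕ.* B) (suc b)) + [ m ]ℚ * C
      ≡⟨ solve 5 (λ x y m r b → x :+ y :+ m :* (r :+ b) := (x :+ m :* r) :+ (y :+ m :* b)) refl
               (weighted (suc (suc a) ℕ.* R) (suc a)) (weighted (suc (suc b) ℕ.* B) (suc b)) [ m ]ℚ
               (weighted R (suc (suc a))) (weighted B (suc (suc b))) ⟩
        (weighted (suc (suc a) ℕ.* R) (suc a) + [ m ]ℚ * weighted R (suc (suc a)))
          + (weighted (suc (suc b) ℕ.* B) (suc b) + [ m ]ℚ * weighted B (suc (suc b)))
      ≤⟨ +-mono-≤ (cliqueTerm-≤ (suc a) R a+2≤k 0≤s ([]ℚ-nonNeg m) 1≤sm)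
                  (cliqueTerm-≤ (suc b) B b+2≤k 0≤s ([]ℚ-nonNeg m) 1≤sm) ⟩
        [ m ]ℚ * (K * ([ R ]ℚ * s ^ℚ suc (suc a))) + [ m ]ℚ * (K * ([ B ]ℚ * s ^ℚ suc (suc b)))
      ≡⟨ solve 4 (λ m K x y → m :* (K :* x) :+ m :* (K :* y) := m :* (K :* (x :+ y))) refl
               [ m ]ℚ K ([ R ]ℚ * s ^ℚ suc (suc a)) ([ B ]ℚ * s ^ℚ suc (suc b)) ⟩
        [ m ]ℚ * (K * ([ R ]ℚ * s ^ℚ suc (suc a) + [ B ]ℚ * s ^ℚ suc (suc b)))
      ∎
      where open ℚₚ.≤-Reasoning

    result : e ^ℚ (suc a ℕ.+ suc b) ≤ cliqueWeight β (suc a) (suc b) S s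
    result = averaging {s} {[ m ]ℚ} {c₀} {e} {d} {K} {[ ℕΣ.∑ S (degreeIn S) ]ℚ} {ℚΣ.∑ S X}
                       {[ R ]ℚ * s ^ℚ suc (suc a) + [ B ]ℚ * s ^ℚ suc (suc b)}
               0<s (1≤s*[m]⇒0<[m] {s} m 1≤sm) 1≤sm 0≤c₀ (<⇒≤ 0<d) (0<K (ℕₚ.≤-trans (s≤s z≤n) a+2≤k))
               eK≤d/2 (dense⇒degreeSum {ρ} {d} dense P (ρn≤size {s} {[ m ]ℚ} (suc a ℕ.+ suc b) 0<s 1≤sm hρ))
               ∑X-≤ summed

  supersaturation : ∀ a b → suc a ℕ.≤ k → suc b ℕ.≤ k → Supersaturated a b
  supersaturation zero    b       _   _   = supersaturated-0 b
  supersaturation (suc a) zero    _   _   = supersaturated-swap (supersaturated-0 (suc a))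
  supersaturation (suc a) (suc b) a<k b<k =
    Step.result a<k b<k (supersaturation a (suc b) (ℕₚ.≤-trans (ℕₚ.n≤1+n (suc a)) a<k) b<k)
                        (supersaturated-swap (supersaturation (suc a) b a<k (ℕₚ.≤-trans (ℕₚ.n≤1+n (suc b)) b<k)))

  allVertices : List (Fin n)
  allVertices = members (λ _ → true)

  length-allVertices : length allVertices ≡ n
  length-allVertices = trans (cong length (filterᵇ-true (allFin n))) (Listₚ.length-tabulate id)

  #cliques-lower-bound : ∀ a → suc a ℕ.≤ k → 0ℚ < [ n ]ℚ → ρ * D ^ℚ (a ℕ.+ a) ≤ 1ℚ →
    e ^ℚ (a ℕ.+ a) * [ n ]ℚ ^ℚ suc a
      ≤ [ #cliques true (suc a) allVertices ℕ.+ #cliques false (suc a) allVertices ]ℚ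
  #cliques-lower-bound a a<k 0<n ρDᵃ⁺ᵃ≤1 = begin
      e ^ℚ (a ℕ.+ a) * [ n ]ℚ ^ℚ suc a
    ≤⟨ *-monoʳ-≤ (^ℚ-nonNeg (suc a) (<⇒≤ 0<n))
                 (supersaturation a a a<k a<k true (λ _ → true) 0<s 1≤s*size hρ) ⟩
      ([ R ]ℚ * s ^ℚ suc a + [ B ]ℚ * s ^ℚ suc a) * [ n ]ℚ ^ℚ suc a
    ≡⟨ solve 4 (λ r b x y → (r :* x :+ b :* x) :* y := (r :+ b) :* (x :* y)) refl
               [ R ]ℚ [ B ]ℚ (s ^ℚ suc a) ([ n ]ℚ ^ℚ suc a) ⟩
      ([ R ]ℚ + [ B ]ℚ) * (s ^ℚ suc a * [ n ]ℚ ^ℚ suc a)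
    ≡⟨ cong (_*_ ([ R ]ℚ + [ B ]ℚ)) (^ℚ-inverse s [ n ]ℚ (suc a) s*n≡1) ⟩
      ([ R ]ℚ + [ B ]ℚ) * 1ℚ
    ≡⟨ trans (ℚₚ.*-identityʳ _) (sym ([]ℚ-homo-+ R B)) ⟩
      [ R ℕ.+ B ]ℚ
    ∎
    where
    open ℚₚ.≤-Reasoning
    R B : ℕ
    R = #cliques true (suc a) allVertices
    B = #cliques false (suc a) allVertices
    s : ℚ
    s = (1/ [ n ]ℚ) {{ℚₚ.pos⇒nonZero [ n ]ℚ {{ℚ.positive 0<n}}}}
    0<s : 0ℚ < s
    0<s = ℚₚ.positive⁻¹ s {{ℚₚ.1/pos⇒pos [ n ]ℚ {{ℚ.positive 0<n}}}}
    s*n≡1 : s * [ n ]ℚ ≡ 1ℚ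
    s*n≡1 = ℚₚ.*-inverseˡ [ n ]ℚ {{ℚₚ.pos⇒nonZero [ n ]ℚ {{ℚ.positive 0<n}}}}
    1≤s*size : 1ℚ ≤ s * [ length allVertices ]ℚ
    1≤s*size = ≤-reflexive (sym (trans (cong (λ x → s * [ x ]ℚ) length-allVertices) s*n≡1))
    hρ : s * ρ * [ n ]ℚ * D ^ℚ (a ℕ.+ a) ≤ 1ℚ
    hρ = ≤-trans (≤-reflexive (trans (solve 4 (λ s ρ N X → s :* ρ :* N :* X := ρ :* X :* (s :* N)) refl
                                             s ρ [ n ]ℚ (D ^ℚ (a ℕ.+ a)))
                                     (trans (cong (_*_ (ρ * D ^ℚ (a ℕ.+ a))) s*n≡1) (ℚₚ.*-identityʳ _))))
                 ρDᵃ⁺ᵃ≤1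

-- From cliques to copies of F

module CliqueCopies {n : ℕ} (Γ : Graph n) (c : TwoColouring Γ) where

  open Cliques Γ c

  record Clique (β : Bool) (a : ℕ) (S : List (Fin n)) : Set where
    field
      vertices : Vec.Vec (Fin n) a
      within   : ∀ i → Vec.lookup vertices i ∈ S
      complete : ∀ i j → ¬ i ≡ j → edge β (Vec.lookup vertices i) (Vec.lookup vertices j) ≡ true
  open Clique

  widen : ∀ {β a} v {S} → Clique β a S → Clique β a (v ∷ S)
  widen v K = record { vertices = vertices K ; within = there ∘ within K ; complete = complete K }

  nbhd-∈⁻ : ∀ β v S {u} → u ∈ nbhd β v S → u ∈ S × edge β v u ≡ true
  nbhd-∈⁻ β v S u∈N with ∈-filter⁻ (Bool.T? ∘ edge β v) {xs = S} u∈N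
  ... | u∈S , edge-vu = u∈S , Equivalence.to T-≡ edge-vu

  extend : ∀ {β a} v S → Clique β a (nbhd β v S) → Clique β (suc a) (v ∷ S)
  extend {β} v S K = record { vertices = v Vec.∷ vertices K ; within = within′ ; complete = complete′ }
    where
    within′ : ∀ i → Vec.lookup (v Vec.∷ vertices K) i ∈ v ∷ S
    within′ Fin.zero    = here refl
    within′ (Fin.suc i) = there (proj₁ (nbhd-∈⁻ β v S (within K i)))
    complete′ : ∀ i j → ¬ i ≡ j →
      edge β (Vec.lookup (v Vec.∷ vertices K) i) (Vec.lookup (v Vec.∷ vertices K) j) ≡ true
    complete′ Fin.zero    Fin.zero    i≢j = ⊥-elim (i≢j refl)
    complete′ Fin.zero    (Fin.suc j) _   = proj₂ (nbhd-∈⁻ β v S (within K j))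
    complete′ (Fin.suc i) Fin.zero    _   =
      trans (edge-sym β (Vec.lookup (vertices K) i) v) (proj₂ (nbhd-∈⁻ β v S (within K i)))
    complete′ (Fin.suc i) (Fin.suc j) i≢j = complete K i j (i≢j ∘ cong Fin.suc)

  cliques : ∀ β a S → List (Clique β a S)
  cliques β zero    S       = record { vertices = Vec.[] ; within = λ () ; complete = λ () } ∷ []
  cliques β (suc a) []      = []
  cliques β (suc a) (v ∷ S) = map (widen v) (cliques β (suc a) S) ++ map (extend v S) (cliques β a (nbhd β v S))

  length-cliques : ∀ β a S → length (cliques β a S) ≡ #cliques β a S
  length-cliques β zero    S       = refl
  length-cliques β (suc a) []      = refl
  length-cliques β (suc a) (v ∷ S) = trans (Listₚ.length-++ (map (widen v) (cliques β (suc a) S)))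
    (cong₂ ℕ._+_ (trans (Listₚ.length-map (widen v) (cliques β (suc a) S)) (length-cliques β (suc a) S))
                 (trans (Listₚ.length-map (extend v S) (cliques β a (nbhd β v S))) (length-cliques β a (nbhd β v S))))

  Image : ∀ {a} → Vec.Vec (Fin n) a → Fin n → Set
  Image w x = ∃ λ i → Vec.lookup w i ≡ x

  SameImage : ∀ {a} → Vec.Vec (Fin n) a → Vec.Vec (Fin n) a → Set
  SameImage w w′ = ∀ x → Image w x ⇔ Image w′ x

  Distinct : ∀ {β a S} → Clique β a S → Clique β a S → Set
  Distinct K L = ¬ SameImage (vertices K) (vertices L)

  Image-∷⁻ : ∀ {a v u} (x y : Vec.Vec (Fin n) a) → ¬ Image x v →
             (Image (v Vec.∷ x) u → Image (v Vec.∷ y) u) → Image x u → Image y u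
  Image-∷⁻ x y v∉x to (i , xi≡u) with to (Fin.suc i , xi≡u)
  ... | Fin.zero  , v≡u  = ⊥-elim (v∉x (i , trans xi≡u (sym v≡u)))
  ... | Fin.suc j , yj≡u = j , yj≡u

  ∉-Image : ∀ {β a} v S → ¬ v ∈ S → (K : Clique β a S) → ¬ Image (vertices K) v
  ∉-Image v S v∉S K (i , Ki≡v) = v∉S (subst (_∈ S) Ki≡v (within K i))

  extend-distinct : ∀ {β a} v S → ¬ v ∈ S → {K L : Clique β a (nbhd β v S)} →
                    Distinct K L → Distinct (extend v S K) (extend v S L)
  extend-distinct {β} v S v∉S {K} {L} K≢L same = K≢L λ u →
    mk⇔ (Image-∷⁻ (vertices K) (vertices L) (v∉nbhd K) (Equivalence.to (same u)))
        (Image-∷⁻ (vertices L) (vertices K) (v∉nbhd L) (Equivalence.from (same u)))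
    where
    v∉nbhd : ∀ M → ¬ Image (vertices M) v
    v∉nbhd = ∉-Image v (nbhd β v S) (v∉S ∘ proj₁ ∘ nbhd-∈⁻ β v S)

  cliques-distinct : ∀ β a S → Unique S → AllPairs.AllPairs Distinct (cliques β a S)
  cliques-distinct β zero    S       _ = All.[] AllPairs.∷ AllPairs.[]
  cliques-distinct β (suc a) []      _ = AllPairs.[]
  cliques-distinct β (suc a) (v ∷ S) (v∉S′ AllPairs.∷ unique) =
    AllPairsₚ.++⁺ {xs = map (widen v) Ks} {ys = map (extend v S) Ls}
      (AllPairsₚ.map⁺ {R = Distinct} {f = widen v} (cliques-distinct β (suc a) S unique))
      (AllPairsₚ.map⁺ {R = Distinct} {f = extend v S}
        (AllPairs.map {R = Distinct} {S = Distinct on extend v S} (λ {K} {L} → extend-distinct v S v∉S {K} {L})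
                      (cliques-distinct β a N (Uniqueₚ.filter⁺ (Bool.T? ∘ edge β v) {xs = S} unique))))
      (Allₚ.map⁺ {f = widen v} (All.universal (λ K → Allₚ.map⁺ {f = extend v S} (All.universal (λ L same →
        ∉-Image v S v∉S K (Equivalence.from (same v) (Fin.zero , refl))) Ls)) Ks))
    where
    N : List (Fin n)
    N = nbhd β v S
    Ks : List (Clique β (suc a) S)
    Ks = cliques β (suc a) S
    Ls : List (Clique β a N)
    Ls = cliques β a N
    v∉S : ¬ v ∈ S
    v∉S = Uniqueₚ.Unique[x∷xs]⇒x∉xs (v∉S′ AllPairs.∷ unique)

  module _ {k} (F : Graph k) (β : Bool) where

    adj⇒≢ : ∀ {i j} → adj F i j ≡ true → ¬ i ≡ j
    adj⇒≢ {i} Fii refl with trans (sym Fii) (Graph.irrefl F i)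
    ... | ()

    cliqueEmbedding : ∀ {S} → Clique β k S → Embedding F Γ
    cliqueEmbedding K = record
      { φ   = Vec.lookup (vertices K)
      ; inj = injective
      ; hom = λ i j Fij → edge⇒adj β _ _ (complete K i j (adj⇒≢ Fij))
      }
      where
      injective : ∀ {i j} → Vec.lookup (vertices K) i ≡ Vec.lookup (vertices K) j → i ≡ j
      injective {i} {j} Ki≡Kj with i Finₚ.≟ j
      ... | yes i≡j = i≡j
      ... | no i≢j with trans (sym (complete K i j i≢j))
                             (trans (cong (λ u → edge β u (Vec.lookup (vertices K) j)) Ki≡Kj) (edge-irrefl β _))
      ...   | ()

    cliqueEmbedding-mono : ∀ {S} (K : Clique β k S) → Monochromatic c (cliqueEmbedding K)
    cliqueEmbedding-mono K = β , λ i j Fij → edge⇒colour β _ _ (complete K i j (adj⇒≢ Fij))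

  cliques⇒copies : ∀ {k} (F : Graph k) β S → Unique S → AtLeastMonoCopies F Γ c [ #cliques β k S ]ℚ
  cliques⇒copies {k} F β S unique =
    map (cliqueEmbedding F β) Ks ,
    Allₚ.map⁺ {f = cliqueEmbedding F β} (All.universal (cliqueEmbedding-mono F β) Ks) ,
    AllPairsₚ.map⁺ {R = λ e e′ → ¬ SameCopy e e′} {f = cliqueEmbedding F β}
      (AllPairs.map (λ K≢L same → K≢L (proj₁ same)) (cliques-distinct β k S unique)) ,
    ≤-reflexive (cong [_]ℚ (sym (trans (Listₚ.length-map (cliqueEmbedding F β) Ks) (length-cliques β k S))))
    where
    Ks : List (Clique β k S)
    Ks = cliques β k S

AtLeastMonoCopies-mono : ∀ {k n} {F : Graph k} {Γ : Graph n} {c : TwoColouring Γ} {x y} →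
  x ≤ y → AtLeastMonoCopies F Γ c y → AtLeastMonoCopies F Γ c x
AtLeastMonoCopies-mono x≤y (L , mono , distinct , y≤) = L , mono , distinct , ≤-trans x≤y y≤

-- The constants and the final count

square≤2^suc : ∀ k → k ℕ.^ 2 ℕ.≤ 2 ℕ.^ suc k
square≤2^suc 0 = z≤n
square≤2^suc 1 = ℕₚ.≤ᵇ⇒≤ 1 4 _
square≤2^suc 2 = ℕₚ.≤ᵇ⇒≤ 4 8 _
square≤2^suc 3 = ℕₚ.≤ᵇ⇒≤ 9 16 _
square≤2^suc (suc (suc (suc (suc j)))) = begin
    (4 ℕ.+ j) ℕ.^ 2
  ≤⟨ ℕₚ.m≤m+n _ (j ℕ.* j ℕ.+ 4 ℕ.* j ℕ.+ 2) ⟩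
    (4 ℕ.+ j) ℕ.^ 2 ℕ.+ (j ℕ.* j ℕ.+ 4 ℕ.* j ℕ.+ 2)
  ≡⟨ trans (cong (λ x → x ℕ.+ (j ℕ.* j ℕ.+ 4 ℕ.* j ℕ.+ 2))
                 (cong ((4 ℕ.+ j) ℕ.*_) (ℕₚ.*-identityʳ (4 ℕ.+ j))))
           (trans (expand j) (cong (2 ℕ.*_) (cong ((3 ℕ.+ j) ℕ.*_) (sym (ℕₚ.*-identityʳ (3 ℕ.+ j)))))) ⟩
    2 ℕ.* (3 ℕ.+ j) ℕ.^ 2
  ≤⟨ ℕₚ.*-monoʳ-≤ 2 (square≤2^suc (suc (suc (suc j)))) ⟩
    2 ℕ.^ (5 ℕ.+ j)
  ∎
  where
  open ℕₚ.≤-Reasoning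
  expand : ∀ x → (4 ℕ.+ x) ℕ.* (4 ℕ.+ x) ℕ.+ (x ℕ.* x ℕ.+ 4 ℕ.* x ℕ.+ 2) ≡
                 2 ℕ.* ((3 ℕ.+ x) ℕ.* (3 ℕ.+ x))
  expand = solve-∀

power≤2^square : ∀ a → suc a ℕ.^ (a ℕ.+ a) ℕ.≤ 2 ℕ.^ (suc a ℕ.* suc a ℕ.+ 3)
power≤2^square a = begin
    suc a ℕ.^ (a ℕ.+ a)
  ≡⟨ cong (suc a ℕ.^_) (cong (a ℕ.+_) (sym (ℕₚ.+-identityʳ a))) ⟩
    suc a ℕ.^ (2 ℕ.* a)
  ≡⟨ sym (ℕₚ.^-*-assoc (suc a) 2 a) ⟩
    (suc a ℕ.^ 2) ℕ.^ a
  ≤⟨ ℕₚ.^-monoˡ-≤ a (square≤2^suc (suc a)) ⟩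
    (2 ℕ.^ suc (suc a)) ℕ.^ a
  ≡⟨ ℕₚ.^-*-assoc 2 (suc (suc a)) a ⟩
    2 ℕ.^ (suc (suc a) ℕ.* a)
  ≤⟨ ℕₚ.^-monoʳ-≤ 2 (ℕₚ.≤-trans (ℕₚ.m≤m+n _ 4) (ℕₚ.≤-reflexive (exponent a))) ⟩
    2 ℕ.^ (suc a ℕ.* suc a ℕ.+ 3)
  ∎
  where
  open ℕₚ.≤-Reasoning
  exponent : ∀ a → suc (suc a) ℕ.* a ℕ.+ 4 ≡ suc a ℕ.* suc a ℕ.+ 3
  exponent = solve-∀

reciprocal-antimono : ∀ {x y x⁻¹ y⁻¹} → 0ℚ ≤ x⁻¹ → 0ℚ ≤ y⁻¹ → x⁻¹ * x ≡ 1ℚ → y⁻¹ * y ≡ 1ℚ →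
                      x ≤ y → y⁻¹ ≤ x⁻¹
reciprocal-antimono {x} {y} {x⁻¹} {y⁻¹} 0≤x⁻¹ 0≤y⁻¹ x⁻¹x≡1 y⁻¹y≡1 x≤y = begin
    y⁻¹
  ≡⟨ sym (trans (cong (y⁻¹ *_) x⁻¹x≡1) (ℚₚ.*-identityʳ y⁻¹)) ⟩
    y⁻¹ * (x⁻¹ * x)
  ≤⟨ *-monoˡ-≤ 0≤y⁻¹ (*-monoˡ-≤ 0≤x⁻¹ x≤y) ⟩
    y⁻¹ * (x⁻¹ * y)
  ≡⟨ trans (solve 3 (λ a b c → a :* (b :* c) := b :* (a :* c)) refl y⁻¹ x⁻¹ y)
           (trans (cong (x⁻¹ *_) y⁻¹y≡1) (ℚₚ.*-identityʳ x⁻¹)) ⟩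
    x⁻¹
  ∎
  where open ℚₚ.≤-Reasoning

¼ : ℚ
¼ = + 1 / 4

module Constants {d : ℚ} (0<d : 0ℚ < d) (d<1 : d < 1ℚ) (a : ℕ) where

  k : ℕ
  k = suc a

  0≤d : 0ℚ ≤ d
  0≤d = <⇒≤ 0<d

  d≤1 : d ≤ 1ℚ
  d≤1 = <⇒≤ d<1

  D : ℚ
  D = _÷_ (+ 4 / 1) d {{>-nonZero 0<d}}

  D*d≡4 : D * d ≡ [ 4 ]ℚ
  D*d≡4 = trans (ℚₚ.*-assoc (+ 4 / 1) ((1/ d) {{>-nonZero 0<d}}) d)
                (trans (cong (_*_ (+ 4 / 1)) (ℚₚ.*-inverseˡ d {{>-nonZero 0<d}})) (ℚₚ.*-identityʳ (+ 4 / 1)))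

  0<D : 0ℚ < D
  0<D = *-pos (ℚₚ.positive⁻¹ (+ 4 / 1))
              (ℚₚ.positive⁻¹ ((1/ d) {{>-nonZero 0<d}}) {{ℚₚ.1/pos⇒pos d {{ℚ.positive 0<d}}}})

  1≤D : 1ℚ ≤ D
  1≤D = begin
      1ℚ        ≤⟨ []ℚ-mono-≤ {1} {4} (s≤s z≤n) ⟩
      [ 4 ]ℚ    ≡⟨ sym D*d≡4 ⟩
      D * d     ≤⟨ *-monoˡ-≤ (<⇒≤ 0<D) d≤1 ⟩
      D * 1ℚ    ≡⟨ ℚₚ.*-identityʳ D ⟩
      D         ∎
    where open ℚₚ.≤-Reasoning

  q : ℚ
  q = d * ¼

  0≤q : 0ℚ ≤ q
  0≤q = *-nonNeg 0≤d (<⇒≤ (ℚₚ.positive⁻¹ ¼))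

  q≤1 : q ≤ 1ℚ
  q≤1 = ≤-trans (*-monoʳ-≤ (<⇒≤ (ℚₚ.positive⁻¹ ¼)) d≤1)
                (≤-trans (≤-reflexive (ℚₚ.*-identityˡ ¼)) (ℚₚ.≤ᵇ⇒≤ _))

  q*D≡1 : q * D ≡ 1ℚ
  q*D≡1 = trans (solve 2 (λ d D → d :* con ¼ :* D := D :* d :* con ¼) refl d D) (cong (_* ¼) D*d≡4)

  instance
    [k]≢0 : ℚ.NonZero [ k ]ℚ
    [k]≢0 = ℚₚ.pos⇒nonZero [ k ]ℚ {{ℚ.positive ([]ℚ-pos a)}}

  0≤1/k : 0ℚ ≤ 1/ [ k ]ℚ
  0≤1/k = <⇒≤ (ℚₚ.positive⁻¹ (1/ [ k ]ℚ) {{ℚₚ.1/pos⇒pos [ k ]ℚ {{ℚ.positive ([]ℚ-pos a)}}}})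

  1/k≤1 : 1/ [ k ]ℚ ≤ 1ℚ
  1/k≤1 = reciprocal-antimono 0≤1 0≤1/k refl (ℚₚ.*-inverseˡ [ k ]ℚ) ([]ℚ-mono-≤ {1} {k} (s≤s z≤n))

  e : ℚ
  e = q ^ℚ suc k * 1/ [ k ]ℚ

  0≤e : 0ℚ ≤ e
  0≤e = *-nonNeg (^ℚ-nonNeg (suc k) 0≤q) 0≤1/k

  e≤1 : e ≤ 1ℚ
  e≤1 = *-mono-≤ (^ℚ-nonNeg (suc k) 0≤q) 0≤1 (^ℚ-antimonoʳ-≤ 0≤q q≤1 {0} {suc k} z≤n) 1/k≤1

  e*K≡d/2 : e * ([ 2 ℕ.* k ]ℚ * D ^ℚ k) ≡ d * ½
  e*K≡d/2 = begin
      q * q ^ℚ k * 1/ [ k ]ℚ * ([ 2 ℕ.* k ]ℚ * D ^ℚ k)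
    ≡⟨ cong (λ x → q * q ^ℚ k * 1/ [ k ]ℚ * (x * D ^ℚ k)) ([]ℚ-homo-* 2 k) ⟩
      q * q ^ℚ k * 1/ [ k ]ℚ * ([ 2 ]ℚ * [ k ]ℚ * D ^ℚ k)
    ≡⟨ solve 5 (λ q x y u w → q :* x :* y :* (con [ 2 ]ℚ :* u :* w) := q :* (x :* w) :* (y :* u) :* con [ 2 ]ℚ) refl
               q (q ^ℚ k) (1/ [ k ]ℚ) [ k ]ℚ (D ^ℚ k) ⟩
      q * (q ^ℚ k * D ^ℚ k) * (1/ [ k ]ℚ * [ k ]ℚ) * [ 2 ]ℚ
    ≡⟨ cong₂ (λ x y → q * x * y * [ 2 ]ℚ) (^ℚ-inverse q D k q*D≡1) (ℚₚ.*-inverseˡ [ k ]ℚ) ⟩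
      q * 1ℚ * 1ℚ * [ 2 ]ℚ
    ≡⟨ solve 1 (λ d → d :* con ¼ :* con 1ℚ :* con 1ℚ :* con [ 2 ]ℚ := d :* con ½) refl d ⟩
      d * ½
    ∎
    where open ≡-Reasoning

  ρDᵃ⁺ᵃ≤1 : ∀ {ρ} → 0ℚ ≤ ρ → ρ ≤ q ^ℚ (2 ℕ.* k) → ρ * D ^ℚ (a ℕ.+ a) ≤ 1ℚ
  ρDᵃ⁺ᵃ≤1 {ρ} 0≤ρ ρ≤ = begin
      ρ * D ^ℚ (a ℕ.+ a)
    ≤⟨ *-monoˡ-≤ 0≤ρ (^ℚ-monoʳ-≤ 1≤D (ℕₚ.m≤n+m (a ℕ.+ a) 2)) ⟩
      ρ * D ^ℚ (2 ℕ.+ (a ℕ.+ a))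
    ≡⟨ cong (λ h → ρ * D ^ℚ h) (solve-2k a) ⟩
      ρ * D ^ℚ (2 ℕ.* k)
    ≤⟨ *-monoʳ-≤ (^ℚ-nonNeg (2 ℕ.* k) (<⇒≤ 0<D)) ρ≤ ⟩
      q ^ℚ (2 ℕ.* k) * D ^ℚ (2 ℕ.* k)
    ≡⟨ ^ℚ-inverse q D (2 ℕ.* k) q*D≡1 ⟩
      1ℚ
    ∎
    where
    open ℚₚ.≤-Reasoning
    solve-2k : ∀ a → 2 ℕ.+ (a ℕ.+ a) ≡ 2 ℕ.* suc a
    solve-2k = solve-∀

  γ≤eᵃ⁺ᵃ/2 : d ^ℚ (2 ℕ.* (k ℕ.* k)) * ½ ^ℚ (5 ℕ.* (k ℕ.* k)) ≤ e ^ℚ (a ℕ.+ a) * ½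
  γ≤eᵃ⁺ᵃ/2 = begin
      d ^ℚ (2 ℕ.* (k ℕ.* k)) * ½ ^ℚ (5 ℕ.* (k ℕ.* k))
    ≤⟨ *-mono-≤ (^ℚ-nonNeg (2 ℕ.* (k ℕ.* k)) 0≤d)
                (*-nonNeg (^ℚ-nonNeg (ℓ ℕ.+ ℓ) 0≤½) (*-nonNeg 0≤½ (^ℚ-nonNeg (a ℕ.+ a) 0≤1/k)))
                (^ℚ-antimonoʳ-≤ 0≤d d≤1 (ℕₚ.≤-trans (ℕₚ.m≤m+n ℓ 2) (ℕₚ.≤-reflexive (ℓ+2≡2kk a))))
                halves ⟩
      d ^ℚ ℓ * (½ ^ℚ (ℓ ℕ.+ ℓ) * (½ * (1/ [ k ]ℚ) ^ℚ (a ℕ.+ a)))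
    ≡⟨ sym expand-e ⟩
      e ^ℚ (a ℕ.+ a) * ½
    ∎
    where
    open ℚₚ.≤-Reasoning
    ℓ : ℕ
    ℓ = suc k ℕ.* (a ℕ.+ a)
    ℓ+2≡2kk : ∀ a → (2 ℕ.+ a) ℕ.* (a ℕ.+ a) ℕ.+ 2 ≡ 2 ℕ.* (suc a ℕ.* suc a)
    ℓ+2≡2kk = solve-∀
    5kk≡ : ∀ a → 5 ℕ.* (suc a ℕ.* suc a) ≡
                 ((2 ℕ.+ a) ℕ.* (a ℕ.+ a) ℕ.+ (2 ℕ.+ a) ℕ.* (a ℕ.+ a)) ℕ.+ suc (suc a ℕ.* suc a ℕ.+ 3)
    5kk≡ = solve-∀
    ½ᵏᵏ⁺³≤ : ½ ^ℚ (k ℕ.* k ℕ.+ 3) ≤ (1/ [ k ]ℚ) ^ℚ (a ℕ.+ a)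
    ½ᵏᵏ⁺³≤ = reciprocal-antimono (^ℚ-nonNeg (a ℕ.+ a) 0≤1/k) (^ℚ-nonNeg (k ℕ.* k ℕ.+ 3) 0≤½)
      (trans (cong ((1/ [ k ]ℚ) ^ℚ (a ℕ.+ a) *_) ([]ℚ-homo-^ k (a ℕ.+ a)))
             (^ℚ-inverse (1/ [ k ]ℚ) [ k ]ℚ (a ℕ.+ a) (ℚₚ.*-inverseˡ [ k ]ℚ)))
      (trans (cong (½ ^ℚ (k ℕ.* k ℕ.+ 3) *_) ([]ℚ-homo-^ 2 (k ℕ.* k ℕ.+ 3)))
             (^ℚ-inverse ½ [ 2 ]ℚ (k ℕ.* k ℕ.+ 3) refl))
      ([]ℚ-mono-≤ (power≤2^square a))
    halves : ½ ^ℚ (5 ℕ.* (k ℕ.* k)) ≤ ½ ^ℚ (ℓ ℕ.+ ℓ) * (½ * (1/ [ k ]ℚ) ^ℚ (a ℕ.+ a))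
    halves = ≤-trans (≤-reflexive (trans (cong (½ ^ℚ_) (5kk≡ a)) (^ℚ-distribˡ-+-* ½ (ℓ ℕ.+ ℓ) _)))
                     (*-monoˡ-≤ (^ℚ-nonNeg (ℓ ℕ.+ ℓ) 0≤½) (*-monoˡ-≤ 0≤½ ½ᵏᵏ⁺³≤))
    expand-e : e ^ℚ (a ℕ.+ a) * ½ ≡ d ^ℚ ℓ * (½ ^ℚ (ℓ ℕ.+ ℓ) * (½ * (1/ [ k ]ℚ) ^ℚ (a ℕ.+ a)))
    expand-e = begin-equality
        e ^ℚ (a ℕ.+ a) * ½
      ≡⟨ cong (_* ½) (^ℚ-distrib-* (q ^ℚ suc k) (1/ [ k ]ℚ) (a ℕ.+ a)) ⟩
        (q ^ℚ suc k) ^ℚ (a ℕ.+ a) * (1/ [ k ]ℚ) ^ℚ (a ℕ.+ a) * ½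
      ≡⟨ cong (λ x → x * (1/ [ k ]ℚ) ^ℚ (a ℕ.+ a) * ½)
              (trans (^ℚ-*-assoc q (suc k) (a ℕ.+ a)) (^ℚ-distrib-* d ¼ ℓ)) ⟩
        d ^ℚ ℓ * ¼ ^ℚ ℓ * (1/ [ k ]ℚ) ^ℚ (a ℕ.+ a) * ½
      ≡⟨ cong (λ x → d ^ℚ ℓ * x * (1/ [ k ]ℚ) ^ℚ (a ℕ.+ a) * ½)
              (trans (^ℚ-distrib-* ½ ½ ℓ) (sym (^ℚ-distribˡ-+-* ½ ℓ ℓ))) ⟩
        d ^ℚ ℓ * ½ ^ℚ (ℓ ℕ.+ ℓ) * (1/ [ k ]ℚ) ^ℚ (a ℕ.+ a) * ½
      ≡⟨ solve 3 (λ x y z → x :* y :* z :* con ½ := x :* (y :* (con ½ :* z))) refl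
               (d ^ℚ ℓ) (½ ^ℚ (ℓ ℕ.+ ℓ)) ((1/ [ k ]ℚ) ^ℚ (a ℕ.+ a)) ⟩
        d ^ℚ ℓ * (½ ^ℚ (ℓ ℕ.+ ℓ) * (½ * (1/ [ k ]ℚ) ^ℚ (a ℕ.+ a)))
      ∎

½[x+y]≤[y] : ∀ {x y} → x ℕ.≤ y → ½ * [ x ℕ.+ y ]ℚ ≤ [ y ]ℚ
½[x+y]≤[y] {x} {y} x≤y = begin
    ½ * [ x ℕ.+ y ]ℚ
  ≤⟨ *-monoˡ-≤ 0≤½ ([]ℚ-mono-≤ (ℕₚ.+-monoˡ-≤ y x≤y)) ⟩
    ½ * [ y ℕ.+ y ]ℚ
  ≡⟨ trans (cong (½ *_) ([]ℚ-homo-+ y y)) (solve 1 (λ y → con ½ :* (y :+ y) := y) refl [ y ]ℚ) ⟩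
    [ y ]ℚ
  ∎
  where open ℚₚ.≤-Reasoning

larger-colour : (f : Bool → ℕ) → ∃ λ β → ½ * [ f true ℕ.+ f false ]ℚ ≤ [ f β ]ℚ
larger-colour f = byComparison (f true ≤? f false)
  where
  byComparison : Dec (f true ℕ.≤ f false) → ∃ λ β → ½ * [ f true ℕ.+ f false ]ℚ ≤ [ f β ]ℚ
  byComparison (yes t≤f) = false , ½[x+y]≤[y] t≤f
  byComparison (no  t≰f) = true , subst (λ x → ½ * [ x ]ℚ ≤ [ f true ]ℚ) (ℕₚ.+-comm (f false) (f true))
                                        (½[x+y]≤[y] (ℕₚ.<⇒≤ (ℕₚ.≰⇒> t≰f)))

corollary2p4 : (k : ℕ) → 2 ℕ.≤ k → (F : Graph k) →
    (d : ℚ) → (0<d : 0ℚ < d) → d < 1ℚ →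
    (n : ℕ) → (_÷_ (+ 4 / 1) d {{>-nonZero 0<d}}) ^ℚ (2 ℕ.* k) ≤ [ n ]ℚ →
    (ρ : ℚ) → 0ℚ < ρ → ρ ≤ (d * (+ 1 / 4)) ^ℚ (2 ℕ.* k) →
    (Γ : Graph n) → Dense ρ d Γ → (c : TwoColouring Γ) →
    AtLeastMonoCopies F Γ c
      (d ^ℚ (2 ℕ.* (k ℕ.* k)) * (+ 1 / 2) ^ℚ (5 ℕ.* (k ℕ.* k)) * [ n ]ℚ ^ℚ k)
corollary2p4 zero    () F d 0<d d<1 n Dᵏ≤n ρ 0<ρ ρ≤ Γ dense c
corollary2p4 (suc a) _  F d 0<d d<1 n Dᵏ≤n ρ 0<ρ ρ≤ Γ dense c =
  AtLeastMonoCopies-mono {F = F} {Γ = Γ} {c = c} γnᵏ≤count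
    (cliques⇒copies F β allVertices (members-unique (λ _ → true)))
  where
  open Constants 0<d d<1 a
  open Supersaturation Γ c dense (<⇒≤ 0<ρ) 0<d D*d≡4 1≤D k 0≤e e≤1 (≤-reflexive e*K≡d/2)
    using (#cliques-lower-bound; allVertices)
  open CliqueCopies Γ c using (cliques⇒copies)
  open Degrees Γ using (members-unique)
  open Cliques Γ c using (#cliques)
  -- The only use of the hypothesis on n.
  0<n : 0ℚ < [ n ]ℚ
  0<n = <-≤-trans (^ℚ-pos (2 ℕ.* k) 0<D) Dᵏ≤n
  count : Bool → ℕ
  count β = #cliques β k allVertices
  β : Bool
  β = proj₁ (larger-colour count)
  γnᵏ≤count : d ^ℚ (2 ℕ.* (k ℕ.* k)) * ½ ^ℚ (5 ℕ.* (k ℕ.* k)) * [ n ]ℚ ^ℚ k ≤ [ count β ]ℚ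
  γnᵏ≤count = begin
      d ^ℚ (2 ℕ.* (k ℕ.* k)) * ½ ^ℚ (5 ℕ.* (k ℕ.* k)) * [ n ]ℚ ^ℚ k
    ≤⟨ *-monoʳ-≤ (^ℚ-nonNeg k (<⇒≤ 0<n)) γ≤eᵃ⁺ᵃ/2 ⟩
      e ^ℚ (a ℕ.+ a) * ½ * [ n ]ℚ ^ℚ k
    ≡⟨ solve 2 (λ x y → x :* con ½ :* y := con ½ :* (x :* y)) refl (e ^ℚ (a ℕ.+ a)) ([ n ]ℚ ^ℚ k) ⟩
      ½ * (e ^ℚ (a ℕ.+ a) * [ n ]ℚ ^ℚ k)
    ≤⟨ *-monoˡ-≤ 0≤½ (#cliques-lower-bound a ℕₚ.≤-refl 0<n (ρDᵃ⁺ᵃ≤1 (<⇒≤ 0<ρ) ρ≤)) ⟩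
      ½ * [ count true ℕ.+ count false ]ℚ
    ≤⟨ proj₂ (larger-colour count) ⟩
      [ count β ]ℚ
    ∎
    where open ℚₚ.≤-Reasoning
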